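{- Let $q\ge2$ be an integer and let $G$ be the incidence graph of a projective plane of order $q$. For every integer $k\ge q+1$, \[\mathrm{capt}_{\zeta,k}(G)\le\left\lceil\frac{q-1}{k-q}\right\rceil+\left\lceil\frac{q}{k-q+1}\right\rceil.\]
   Context: A (finite) projective plane of order $q$ has $q^2+q+1$ points and $q^2+q+1$ lines, every two distinct points lie on exactly one common line, every two distinct lines meet in exactly one point, each line has $q+1$ points and each point lies on $q+1$ lines. Its incidence graph is the bipartite graph on points and lines, with a point adjacent to a line iff they are incident. The localization game on a connected graph $G$ with $k$ cops: the robber, invisible to the cops, first chooses a starting vertex. In each round the cops choose a multiset of vertices $u_1,\dots,u_k$ (no adjacency restriction) and learn the distances $d(u_i,R)$ to the robber's current vertex $R$; the cops capture the robber if, from all information so far, they can determine the robber's vertex uniquely. If not captured, the robber moves to a neighbor or stays. The robber is omniscient. The localization number $\zeta(G)$ is the least number of cops guaranteeing capture (for these incidence graphs $\zeta(G)=q+1$). For $k\ge\zeta(G)$, $\mathrm{capt}_{\zeta,k}(G)$ is the minimum number of rounds in which $k$ cops can guarantee capture under optimal play. -}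

module Defs where

open import Data.Nat using (ℕ; zero; suc; _+_; _*_; _∸_; _/_)
open import Data.Bool using (Bool; true; false; _∧_; _∨_; if_then_else_; T)
open import Data.Fin using (Fin)
import Data.Fin.Properties as FinP
open import Data.Sum using (_⊎_; inj₁; inj₂)
open import Data.Sum.Properties using (≡-dec)
open import Data.Product using (Σ; ∃; _×_; _,_)
open import Data.List using (List; []; _∷_)
open import Data.Vec using (Vec; map)
open import Relation.Nullary.Decidable using (⌊_⌋)
open import Relation.Binary.PropositionalEquality using (_≡_)
open import Relation.Nullary using (¬_)

-- Ceiling division ⌈a / b⌉ (only used with b ≥ 1; the b = 0 case is junk)

ceilDiv : ℕ → ℕ → ℕ
ceilDiv a zero    = 0
ceilDiv a (suc b) = (a + b) / suc b

countFin : ∀ {n} → (Fin n → Bool) → ℕ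
countFin {zero}  f = 0
countFin {suc n} f = (if f Fin.zero then 1 else 0) + countFin (λ i → f (Fin.suc i))

anyFin : ∀ {n} → (Fin n → Bool) → Bool
anyFin {zero}  f = false
anyFin {suc n} f = f Fin.zero ∨ anyFin (λ i → f (Fin.suc i))

record ProjectivePlane (q : ℕ) : Set where
  field
    inc : Fin (q * q + q + 1) → Fin (q * q + q + 1) → Bool
    pointsLine : ∀ p p′ → ¬ p ≡ p′ →
      Σ (Fin (q * q + q + 1)) λ l → T (inc p l) × T (inc p′ l) ×
        (∀ l′ → T (inc p l′) → T (inc p′ l′) → l′ ≡ l)
    linesMeet : ∀ l l′ → ¬ l ≡ l′ →
      Σ (Fin (q * q + q + 1)) λ p → T (inc p l) × T (inc p l′) ×
        (∀ p′ → T (inc p′ l) → T (inc p′ l′) → p′ ≡ p)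
    lineSize : ∀ l → countFin (λ p → inc p l) ≡ q + 1
    pointDeg : ∀ p → countFin (λ l → inc p l) ≡ q + 1

-- Incidence graph: vertices are points (inj₁) and lines (inj₂).

module IncidenceGraph {q : ℕ} (P : ProjectivePlane q) where
  open ProjectivePlane P

  N : ℕ
  N = q * q + q + 1

  V : Set
  V = Fin N ⊎ Fin N

  adj : V → V → Bool
  adj (inj₁ p) (inj₂ l) = inc p l
  adj (inj₂ l) (inj₁ p) = inc p l
  adj _        _        = false

  eqV : V → V → Bool
  eqV u v = ⌊ ≡-dec FinP._≟_ FinP._≟_ u v ⌋

  anyV : (V → Bool) → Bool
  anyV f = anyFin (λ p → f (inj₁ p)) ∨ anyFin (λ l → f (inj₂ l))

  within : ℕ → V → V → Bool
  within zero    u v = eqV u v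
  within (suc d) u v = within d u v ∨ anyV (λ w → adj u w ∧ within d w v)

  search : ℕ → ℕ → V → V → ℕ
  search zero       d u v = d
  search (suc fuel) d u v = if within d u v then d else search fuel (suc d) u v

  -- graph distance (shortest path length; |V| = 2N bounds it in a connected graph)
  dist : V → V → ℕ
  dist u v = search (N + N) 0 u v

module Localization (V : Set) (adj : V → V → Bool) (dist : V → V → ℕ) where

  ValidWalk : (ℕ → V) → Set
  ValidWalk w = ∀ i → w (suc i) ≡ w i ⊎ T (adj (w i) (w (suc i)))

  -- a deterministic cop strategy with k cops: the probed multiset in each
  -- round is a function of all responses received so far
  Strategy : ℕ → Set
  Strategy k = List (Vec ℕ k) → Vec V k

  -- responses of rounds 0, …, t-1 (most recent first) against robber walk w
  history : ∀ {k} → Strategy k → (ℕ → V) → ℕ → List (Vec ℕ k)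
  history σ w zero    = []
  history σ w (suc t) =
    map (λ u → dist u (w t)) (σ (history σ w t)) ∷ history σ w t

  -- the robber is located in round t (0-indexed): every valid walk producing
  -- the same responses up to and including round t is at the same vertex
  CapturedAt : ∀ {k} → Strategy k → (ℕ → V) → ℕ → Set
  CapturedAt σ w t = ∀ w′ → ValidWalk w′ →
    history σ w′ (suc t) ≡ history σ w (suc t) → w′ t ≡ w t

  CapturesWithin : ∀ {k} → Strategy k → ℕ → Set
  CapturesWithin σ R = ∀ w → ValidWalk w →
    Σ ℕ λ t → Data.Nat._<_ t R × CapturedAt σ w t

  CaptLE : ℕ → ℕ → Set
  CaptLE k R = Σ (Strategy k) λ σ → CapturesWithin σ R

CaptIncLE : ∀ {q} → ProjectivePlane q → ℕ → ℕ → Set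
CaptIncLE P k R = Localization.CaptLE G.V G.adj G.dist k R
  where module G = IncidenceGraph P

-- Fix a line ℓ and a point O on it.  While the robber may be on any of several
-- lines through O, the cops probe the q points of ℓ other than O and k − q of
-- those lines.  The responses locate a robber on ℓ, pin a line not through O to
-- the lines through its intersection with ℓ, and otherwise either locate the
-- robber or exclude k − q more lines through O, which takes ⌈(q − 1)/(k − q)⌉
-- rounds.  Once the robber is confined to the points of one line M (or, dually,
-- to the lines through one point), all candidates but one are probed and the
-- remaining cops probe points of a second line L through x ∈ M.  Whatever line
-- through a candidate the robber moves to, the responses confine it to the lines
-- joining one point to unprobed points: a dual pinned state with at least
-- k − q + 1 fewer candidates.  This gives ⌈q/(k − q + 1)⌉ more rounds, and the
-- bound follows from a potential that drops in every round.
module Submission where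

open import Data.Nat using (ℕ; zero; suc; pred; _+_; _*_; _∸_; _⊓_; _≤_; _<_; z≤n; s≤s; _/_)
import Data.Nat as ℕ
open import Data.Nat.Properties hiding (_≟_)
open import Data.Nat.DivMod using (/-monoˡ-≤; m/n≡1+[m∸n]/n; m≥n⇒m/n>0; m<n⇒m/n≡0)
open import Data.Bool using (Bool; true; false; not; _∧_; _∨_; if_then_else_; T)
open import Data.Bool.Properties using (T-∧; T-∨; T?)
open import Data.Bool.ListAction using (any)
open import Data.Unit using (⊤; tt)
open import Data.Empty using (⊥; ⊥-elim)
open import Data.Maybe using (Maybe; just; nothing; maybe)
open import Data.Fin using (Fin; fromℕ<)
open import Data.Fin.Properties using (_≟_; any?)
import Data.Fin.Properties as FinP
open import Data.Sum using (_⊎_; inj₁; inj₂; swap)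
open import Data.Sum.Properties using (≡-dec; swap-involutive)
open import Data.Product using (∃; _×_; _,_; proj₁; proj₂)
open import Data.List using (List; []; _∷_; map; length; filter; take; drop; _++_)
open import Data.List.Properties
  using (length-map; length-drop; length-take; length-++; filter-all; take++drop≡id; take-all; ∷-injectiveʳ)
open import Data.List.Relation.Unary.Any using (here; there)
import Data.List.Relation.Unary.Any as Any
open import Data.List.Relation.Unary.Any.Properties using (any⁺; any⁻; singleton⁻)
open import Data.List.Relation.Unary.All using (All; _∷_)
import Data.List.Relation.Unary.All as All
open import Data.List.Relation.Unary.All.Properties using () renaming (drop⁺ to All-drop⁺)
open import Data.List.Relation.Unary.AllPairs using ([]; _∷_)
open import Data.List.Membership.Propositional using (_∈_; _∉_; find; lose)
open import Data.List.Membership.Propositional.Properties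
  using (∈-map⁺; ∈-map⁻; ∈-filter⁺; ∈-filter⁻; ∈-++⁺ˡ; ∈-++⁺ʳ; ∈-++⁻)
open import Data.List.Relation.Unary.Unique.Propositional using (Unique)
import Data.List.Membership.DecPropositional as DecMembership
import Data.List.Relation.Unary.Unique.Propositional.Properties as UniqueP
open import Data.Vec using (Vec; _∷_)
import Data.Vec as Vec
import Data.Vec.Properties as VecP
open import Function using (Equivalence)
open import Relation.Nullary using (¬_; Dec; yes; no; does; ¬?)
open import Relation.Nullary.Decidable using (⌊_⌋; toWitness; fromWitness)
open import Relation.Binary.Definitions using (DecidableEquality)
open import Relation.Binary.PropositionalEquality
  using (_≡_; _≢_; refl; sym; trans; cong; cong₂; subst; subst₂; module ≡-Reasoning)
open import Defs

open Equivalence using (to; from)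

-- Finite enumerations and lists

anyFin⁺ : ∀ {n} (f : Fin n → Bool) i → T (f i) → T (anyFin f)
anyFin⁺ f Fin.zero    t = from T-∨ (inj₁ t)
anyFin⁺ f (Fin.suc i) t = from (T-∨ {f Fin.zero}) (inj₂ (anyFin⁺ (λ j → f (Fin.suc j)) i t))

anyFin⁻ : ∀ {n} (f : Fin n → Bool) → T (anyFin f) → ∃ λ i → T (f i)
anyFin⁻ {suc n} f t with to (T-∨ {f Fin.zero}) t
... | inj₁ t₀ = Fin.zero , t₀
... | inj₂ t₁ with anyFin⁻ (λ j → f (Fin.suc j)) t₁
...   | i , tᵢ = Fin.suc i , tᵢ

-- Defined by the recursion of countFin, so that its length is countFin f.
filterFin : ∀ {n} → (Fin n → Bool) → List (Fin n)
filterFin {zero}  f = []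
filterFin {suc n} f with f Fin.zero
... | true  = Fin.zero ∷ map Fin.suc (filterFin (λ j → f (Fin.suc j)))
... | false = map Fin.suc (filterFin (λ j → f (Fin.suc j)))

length-filterFin : ∀ {n} (f : Fin n → Bool) → length (filterFin f) ≡ countFin f
length-filterFin {zero}  f = refl
length-filterFin {suc n} f with f Fin.zero
... | true  = cong suc (trans (length-map Fin.suc (filterFin (λ j → f (Fin.suc j)))) (length-filterFin (λ j → f (Fin.suc j))))
... | false = trans (length-map Fin.suc (filterFin (λ j → f (Fin.suc j)))) (length-filterFin (λ j → f (Fin.suc j)))

∈-filterFin⁺ : ∀ {n} (f : Fin n → Bool) {i} → T (f i) → i ∈ filterFin f
∈-filterFin⁺ {suc n} f {Fin.zero} t with f Fin.zero
... | true = here refl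
∈-filterFin⁺ {suc n} f {Fin.suc i} t with f Fin.zero
... | true  = there (∈-map⁺ Fin.suc (∈-filterFin⁺ (λ j → f (Fin.suc j)) t))
... | false = ∈-map⁺ Fin.suc (∈-filterFin⁺ (λ j → f (Fin.suc j)) t)

∈-filterFin⁻ : ∀ {n} (f : Fin n → Bool) {i} → i ∈ filterFin f → T (f i)
∈-filterFin⁻ {suc n} f m with f Fin.zero in f₀
∈-filterFin⁻ {suc n} f (here refl) | true rewrite f₀ = _
∈-filterFin⁻ {suc n} f (there m)   | true with ∈-map⁻ Fin.suc m
... | j , jm , refl = ∈-filterFin⁻ (λ j → f (Fin.suc j)) jm
∈-filterFin⁻ {suc n} f m | false with ∈-map⁻ Fin.suc m
... | j , jm , refl = ∈-filterFin⁻ (λ j → f (Fin.suc j)) jm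

filterFin-unique : ∀ {n} (f : Fin n → Bool) → Unique (filterFin f)
filterFin-unique {zero}  f = []
filterFin-unique {suc n} f with f Fin.zero
... | true  = All.tabulate zero∉ ∷ rest
  where
    rest = UniqueP.map⁺ FinP.suc-injective (filterFin-unique (λ j → f (Fin.suc j)))
    zero∉ : ∀ {x} → x ∈ map Fin.suc (filterFin (λ j → f (Fin.suc j))) → Fin.zero ≢ x
    zero∉ m refl with ∈-map⁻ Fin.suc m
    ... | _ , _ , ()
... | false = UniqueP.map⁺ FinP.suc-injective (filterFin-unique (λ j → f (Fin.suc j)))

¬T⇒T-not : ∀ {b} → ¬ T b → T (not b)
¬T⇒T-not {true}  ¬t = ¬t _
¬T⇒T-not {false} _  = _

T-not⇒¬T : ∀ {b} → T (not b) → ¬ T b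
T-not⇒¬T {false} _ ()

module ListFacts {A : Set} where

  length≤1⇒≡ : ∀ {xs : List A} {a b} → length xs ≤ 1 → a ∈ xs → b ∈ xs → a ≡ b
  length≤1⇒≡ {_ ∷ []} _ (here refl) (here refl) = refl
  length≤1⇒≡ {_ ∷ _ ∷ _} (s≤s ()) _ _

  headOr : A → List A → A
  headOr d []      = d
  headOr d (x ∷ _) = x

  headOr-∈ : ∀ d {xs : List A} → 1 ≤ length xs → headOr d xs ∈ xs
  headOr-∈ d {_ ∷ _} _ = here refl

  ∈-take⊎drop : ∀ r {z} (xs : List A) → z ∈ xs → z ∈ take r xs ⊎ z ∈ drop r xs
  ∈-take⊎drop r xs m = ∈-++⁻ (take r xs) (subst (_ ∈_) (sym (take++drop≡id r xs)) m)

  ∃-∈-take : ∀ {r} {xs : List A} → 1 ≤ r → 1 ≤ length xs → ∃ λ z → z ∈ take r xs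
  ∃-∈-take {suc r} {x ∷ xs} _ _ = x , here refl

  two-in-take : ∀ n {xs : List A} → Unique xs → 2 ≤ length xs → n ≢ 0 →
    ∃ λ a → ∃ λ b → a ∈ take (suc n) xs × b ∈ take (suc n) xs × a ≢ b
  two-in-take zero    _ _ n≢0 = ⊥-elim (n≢0 refl)
  two-in-take (suc n) {_ ∷ []} _ (s≤s ()) _
  two-in-take (suc n) {a ∷ b ∷ _} ((a≢b All.∷ _) ∷ _) _ _ = a , b , here refl , there (here refl) , a≢b

  ∈-take⇒∈ : ∀ r {z} (xs : List A) → z ∈ take r xs → z ∈ xs
  ∈-take⇒∈ r xs m = subst (_ ∈_) (take++drop≡id r xs) (∈-++⁺ˡ m)

  ∈-drop⇒∈ : ∀ r {z} (xs : List A) → z ∈ drop r xs → z ∈ xs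
  ∈-drop⇒∈ r xs m = subst (_ ∈_) (take++drop≡id r xs) (∈-++⁺ʳ (take r xs) m)

  map-unique : ∀ {B : Set} (f : A → B) {xs : List A} →
    (∀ {a b} → a ∈ xs → b ∈ xs → f a ≡ f b → a ≡ b) → Unique xs → Unique (map f xs)
  map-unique f {[]} inj [] = []
  map-unique f {x ∷ xs} inj (x∉ ∷ u) =
    All.tabulate fresh ∷ map-unique f (λ a b → inj (there a) (there b)) u
    where
      fresh : ∀ {y} → y ∈ map f xs → f x ≢ y
      fresh m e with ∈-map⁻ f m
      ... | a , am , refl = All.lookup x∉ am (inj (here refl) (there am) e)

  toVec : ∀ k → A → List A → Vec A k
  toVec zero    d xs       = Vec.[]
  toVec (suc k) d []       = d ∷ toVec k d []
  toVec (suc k) d (x ∷ xs) = x ∷ toVec k d xs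

  toVec-map-≡ : ∀ {B : Set} (f g : A → B) k d {xs : List A} → length xs ≤ k →
    Vec.map f (toVec k d xs) ≡ Vec.map g (toVec k d xs) → ∀ {a} → a ∈ xs → f a ≡ g a
  toVec-map-≡ f g (suc k) d {x ∷ xs} (s≤s le) e (here refl) = proj₁ (VecP.∷-injective e)
  toVec-map-≡ f g (suc k) d {x ∷ xs} (s≤s le) e (there m) =
    toVec-map-≡ f g k d le (proj₂ (VecP.∷-injective e)) m

module DecListFacts {A : Set} (_≟_ : DecidableEquality A) where

  ∃-other : ∀ {xs : List A} → Unique xs → 2 ≤ length xs → ∀ a → ∃ λ b → b ∈ xs × b ≢ a
  ∃-other {_ ∷ []} _ (s≤s ()) a
  ∃-other {x ∷ y ∷ _} ((x≢y All.∷ _) ∷ _) _ a with x ≟ a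
  ... | no x≢a   = x , here refl , x≢a
  ... | yes refl = y , there (here refl) , λ e → x≢y (sym e)

  _without_ : List A → A → List A
  xs without x = filter (λ y → ¬? (y ≟ x)) xs

  ∈-without⁺ : ∀ {x y} {xs : List A} → y ∈ xs → y ≢ x → y ∈ xs without x
  ∈-without⁺ m ne = ∈-filter⁺ (λ y → ¬? (y ≟ _)) m ne

  ∈-without⁻ : ∀ {x y} {xs : List A} → y ∈ xs without x → y ∈ xs × y ≢ x
  ∈-without⁻ = ∈-filter⁻ (λ y → ¬? (y ≟ _))

  without-unique : ∀ {x} {xs : List A} → Unique xs → Unique (xs without x)
  without-unique = UniqueP.filter⁺ (λ y → ¬? (y ≟ _))

  length-without : ∀ {x} {xs : List A} → Unique xs → x ∈ xs → suc (length (xs without x)) ≡ length xs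
  length-without {x} {z ∷ zs} (z∉ ∷ u) m with z ≟ x
  length-without {x} {z ∷ zs} (z∉ ∷ u) m | yes refl =
    cong (λ ys → suc (length ys)) (filter-all (λ y → ¬? (y ≟ x)) (All.map (λ ne e → ne (sym e)) z∉))
  length-without {x} {z ∷ zs} (z∉ ∷ u) (here e)  | no ne = ⊥-elim (ne (sym e))
  length-without {x} {z ∷ zs} (z∉ ∷ u) (there m) | no ne = cong suc (length-without u m)

open ListFacts

-- Projective planes

dual : ∀ {q} → ProjectivePlane q → ProjectivePlane q
dual P = record
  { inc        = λ l p → inc p l
  ; pointsLine = linesMeet
  ; linesMeet  = pointsLine
  ; lineSize   = pointDeg
  ; pointDeg   = lineSize
  }
  where open ProjectivePlane P

module Incidence {q : ℕ} (P : ProjectivePlane q) where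
  open ProjectivePlane P

  Elem : Set
  Elem = Fin (q * q + q + 1)

  open DecListFacts (_≟_ {n = q * q + q + 1})
    using (_without_; ∈-without⁺; ∈-without⁻; without-unique; length-without)

  Inc : Elem → Elem → Set
  Inc p l = T (inc p l)

  line-unique : ∀ {p p′ l l′} → p ≢ p′ → Inc p l → Inc p′ l → Inc p l′ → Inc p′ l′ → l ≡ l′
  line-unique {p} {p′} {l} {l′} p≢p′ pl p′l pl′ p′l′ with pointsLine p p′ p≢p′
  ... | _ , _ , _ , unique = trans (unique l pl p′l) (sym (unique l′ pl′ p′l′))

  -- junk value p when p ≡ p′
  join : Elem → Elem → Elem
  join p p′ with any? (λ l → T? (inc p l ∧ inc p′ l))
  ... | yes (l , _) = l
  ... | no _        = p

  join-inc : ∀ {p p′} → p ≢ p′ → Inc p (join p p′) × Inc p′ (join p p′)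
  join-inc {p} {p′} p≢p′ with any? (λ l → T? (inc p l ∧ inc p′ l))
  ... | yes (_ , t) = to T-∧ t
  ... | no none with pointsLine p p′ p≢p′
  ...   | l , pl , p′l , _ = ⊥-elim (none (l , from T-∧ (pl , p′l)))

  pointsOn : Elem → List Elem
  pointsOn l = filterFin (λ p → inc p l)

  pointsOnExcept : Elem → Elem → List Elem
  pointsOnExcept l x = pointsOn l without x

  ∈-pointsOnExcept⁺ : ∀ {l x y} → Inc y l → y ≢ x → y ∈ pointsOnExcept l x
  ∈-pointsOnExcept⁺ {l} yl y≢x = ∈-without⁺ (∈-filterFin⁺ (λ p → inc p l) yl) y≢x

  ∈-pointsOnExcept⁻ : ∀ {l x y} → y ∈ pointsOnExcept l x → Inc y l × y ≢ x
  ∈-pointsOnExcept⁻ {l} m with ∈-without⁻ m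
  ... | m′ , y≢x = ∈-filterFin⁻ (λ p → inc p l) m′ , y≢x

  pointsOnExcept-unique : ∀ {l x} → Unique (pointsOnExcept l x)
  pointsOnExcept-unique {l} = without-unique (filterFin-unique (λ p → inc p l))

  length-pointsOnExcept : ∀ {l x} → Inc x l → length (pointsOnExcept l x) ≡ q
  length-pointsOnExcept {l} {x} xl = suc-injective (begin
    suc (length (pointsOnExcept l x))
      ≡⟨ length-without (filterFin-unique (λ p → inc p l)) (∈-filterFin⁺ (λ p → inc p l) xl) ⟩
    length (pointsOn l)            ≡⟨ length-filterFin (λ p → inc p l) ⟩
    countFin (λ p → inc p l)       ≡⟨ lineSize l ⟩
    q + 1                          ≡⟨ +-comm q 1 ⟩
    suc q                          ∎)
    where open ≡-Reasoning

  pointOn : ∀ l → ∃ λ p → Inc p l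
  pointOn l with pointsOn l in eq | trans (length-filterFin (λ p → inc p l)) (lineSize l)
  ... | p ∷ _ | _ = p , ∈-filterFin⁻ (λ p → inc p l) (subst (p ∈_) (sym eq) (here refl))
  ... | []    | len0≡q+1 = ⊥-elim (0≢q+1 len0≡q+1)
    where
      0≢q+1 : 0 ≢ q + 1
      0≢q+1 e with trans e (+-comm q 1)
      ... | ()

module PlaneFacts {q : ℕ} (P : ProjectivePlane q) where
  open Incidence P public
  private module Dual = Incidence (dual P)

  point-unique : ∀ {l l′ p p′} → l ≢ l′ → Inc p l → Inc p l′ → Inc p′ l → Inc p′ l′ → p ≡ p′
  point-unique = Dual.line-unique

  meet : Elem → Elem → Elem
  meet = Dual.join

  meet-inc : ∀ {l l′} → l ≢ l′ → Inc (meet l l′) l × Inc (meet l l′) l′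
  meet-inc = Dual.join-inc

  linesThroughExcept : Elem → Elem → List Elem
  linesThroughExcept = Dual.pointsOnExcept

  ∈-linesThroughExcept⁺ : ∀ {p l l′} → Inc p l′ → l′ ≢ l → l′ ∈ linesThroughExcept p l
  ∈-linesThroughExcept⁺ = Dual.∈-pointsOnExcept⁺

  ∈-linesThroughExcept⁻ : ∀ {p l l′} → l′ ∈ linesThroughExcept p l → Inc p l′ × l′ ≢ l
  ∈-linesThroughExcept⁻ = Dual.∈-pointsOnExcept⁻

  linesThroughExcept-unique : ∀ {p l} → Unique (linesThroughExcept p l)
  linesThroughExcept-unique = Dual.pointsOnExcept-unique

  length-linesThroughExcept : ∀ {p l} → Inc p l → length (linesThroughExcept p l) ≡ q
  length-linesThroughExcept = Dual.length-pointsOnExcept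

-- Distances in the incidence graph

Vertex : ℕ → Set
Vertex q = Fin (q * q + q + 1) ⊎ Fin (q * q + q + 1)

incDist : ∀ {q} → ProjectivePlane q → Vertex q → Vertex q → ℕ
incDist P (inj₁ p) (inj₁ p′) = if does (p ≟ p′) then 0 else 2
incDist P (inj₂ l) (inj₂ l′) = if does (l ≟ l′) then 0 else 2
incDist P (inj₁ p) (inj₂ l)  = if ProjectivePlane.inc P p l then 1 else 3
incDist P (inj₂ l) (inj₁ p)  = if ProjectivePlane.inc P p l then 1 else 3

incDist-swap : ∀ {q} (P : ProjectivePlane q) (a b : Vertex q) →
  incDist P (swap a) (swap b) ≡ incDist (dual P) a b
incDist-swap P (inj₁ a) (inj₁ b) = refl
incDist-swap P (inj₁ a) (inj₂ b) = refl
incDist-swap P (inj₂ a) (inj₁ b) = refl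
incDist-swap P (inj₂ a) (inj₂ b) = refl

adj-swap : ∀ {q} (P : ProjectivePlane q) (a b : Vertex q) →
  IncidenceGraph.adj P (swap a) (swap b) ≡ IncidenceGraph.adj (dual P) a b
adj-swap P (inj₁ a) (inj₁ b) = refl
adj-swap P (inj₁ a) (inj₂ b) = refl
adj-swap P (inj₂ a) (inj₁ b) = refl
adj-swap P (inj₂ a) (inj₂ b) = refl

module GraphDistance {q : ℕ} (P : ProjectivePlane q) where
  open ProjectivePlane P
  open PlaneFacts P
  open IncidenceGraph P

  eqV-refl : ∀ u → T (eqV u u)
  eqV-refl u = fromWitness {a? = ≡-dec _≟_ _≟_ u u} refl

  eqV⇒≡ : ∀ {u v} → T (eqV u v) → u ≡ v
  eqV⇒≡ {u} {v} = toWitness {a? = ≡-dec _≟_ _≟_ u v}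

  anyV⁺ : ∀ (f : V → Bool) w → T (f w) → T (anyV f)
  anyV⁺ f (inj₁ p) t = from T-∨ (inj₁ (anyFin⁺ (λ p → f (inj₁ p)) p t))
  anyV⁺ f (inj₂ l) t = from (T-∨ {anyFin (λ p → f (inj₁ p))}) (inj₂ (anyFin⁺ (λ l → f (inj₂ l)) l t))

  anyV⁻ : ∀ (f : V → Bool) → T (anyV f) → ∃ λ w → T (f w)
  anyV⁻ f t with to (T-∨ {anyFin (λ p → f (inj₁ p))}) t
  ... | inj₁ tp with anyFin⁻ (λ p → f (inj₁ p)) tp
  ...   | p , t′ = inj₁ p , t′
  anyV⁻ f t | inj₂ tl with anyFin⁻ (λ l → f (inj₂ l)) tl
  ...   | l , t′ = inj₂ l , t′

  within-refl : ∀ d u → T (within d u u)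
  within-refl zero    u = eqV-refl u
  within-refl (suc d) u = from T-∨ (inj₁ (within-refl d u))

  within-step : ∀ d u w v → T (adj u w) → T (within d w v) → T (within (suc d) u v)
  within-step d u w v uw wv =
    from (T-∨ {within d u v}) (inj₂ (anyV⁺ (λ w → adj u w ∧ within d w v) w (from T-∧ (uw , wv))))

  within-incDist : ∀ u v → T (within (incDist P u v) u v)
  within-incDist (inj₁ p) (inj₁ p′) with p ≟ p′
  ... | yes refl = within-refl 0 (inj₁ p)
  ... | no p≢p′ = within-step 1 (inj₁ p) (inj₂ (join p p′)) (inj₁ p′) (proj₁ pp′)
                    (within-step 0 (inj₂ (join p p′)) (inj₁ p′) (inj₁ p′) (proj₂ pp′) (within-refl 0 (inj₁ p′)))
    where pp′ = join-inc p≢p′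
  within-incDist (inj₂ l) (inj₂ l′) with l ≟ l′
  ... | yes refl = within-refl 0 (inj₂ l)
  ... | no l≢l′ = within-step 1 (inj₂ l) (inj₁ (meet l l′)) (inj₂ l′) (proj₁ ll′)
                    (within-step 0 (inj₁ (meet l l′)) (inj₂ l′) (inj₂ l′) (proj₂ ll′) (within-refl 0 (inj₂ l′)))
    where ll′ = meet-inc l≢l′
  within-incDist (inj₁ p) (inj₂ l) with inc p l in e | pointOn l
  ... | true  | _ = within-step 0 (inj₁ p) (inj₂ l) (inj₂ l) (subst T (sym e) _) (within-refl 0 (inj₂ l))
  ... | false | p′ , p′l = within-step 2 (inj₁ p) (inj₂ (join p p′)) (inj₂ l) (proj₁ pp′)
                            (within-step 1 (inj₂ (join p p′)) (inj₁ p′) (inj₂ l) (proj₂ pp′)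
                              (within-step 0 (inj₁ p′) (inj₂ l) (inj₂ l) p′l (within-refl 0 (inj₂ l))))
    where
      p≢p′ : p ≢ p′
      p≢p′ refl = subst T e p′l
      pp′ = join-inc p≢p′
  within-incDist (inj₂ l) (inj₁ p) with inc p l in e | pointOn l
  ... | true  | _ = within-step 0 (inj₂ l) (inj₁ p) (inj₁ p) (subst T (sym e) _) (within-refl 0 (inj₁ p))
  ... | false | p′ , p′l = within-step 2 (inj₂ l) (inj₁ p′) (inj₁ p) p′l
                            (within-step 1 (inj₁ p′) (inj₂ (join p′ p)) (inj₁ p) (proj₁ p′p)
                              (within-step 0 (inj₂ (join p′ p)) (inj₁ p) (inj₁ p) (proj₂ p′p) (within-refl 0 (inj₁ p))))
    where
      p′≢p : p′ ≢ p
      p′≢p refl = subst T e p′l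
      p′p = join-inc p′≢p

  incDist-self : ∀ u → incDist P u u ≡ 0
  incDist-self (inj₁ p) with p ≟ p
  ... | yes _   = refl
  ... | no p≢p = ⊥-elim (p≢p refl)
  incDist-self (inj₂ l) with l ≟ l
  ... | yes _   = refl
  ... | no l≢l = ⊥-elim (l≢l refl)

  incDist-adj : ∀ u w v → T (adj u w) → incDist P u v ≤ suc (incDist P w v)
  incDist-adj (inj₁ p) (inj₂ l) (inj₁ p′) _ with p ≟ p′ | inc p′ l
  ... | yes _ | _     = z≤n
  ... | no _  | true  = ≤-refl
  ... | no _  | false = s≤s (s≤s z≤n)
  incDist-adj (inj₁ p) (inj₂ l) (inj₂ l′) pl with l ≟ l′
  incDist-adj (inj₁ p) (inj₂ l) (inj₂ l) pl | yes refl with inc p l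
  ... | true = ≤-refl
  incDist-adj (inj₁ p) (inj₂ l) (inj₂ l′) pl | no _ with inc p l′
  ... | true  = s≤s z≤n
  ... | false = ≤-refl
  incDist-adj (inj₂ l) (inj₁ p) (inj₂ l′) _ with l ≟ l′ | inc p l′
  ... | yes _ | _     = z≤n
  ... | no _  | true  = ≤-refl
  ... | no _  | false = s≤s (s≤s z≤n)
  incDist-adj (inj₂ l) (inj₁ p) (inj₁ p′) pl with p ≟ p′
  incDist-adj (inj₂ l) (inj₁ p) (inj₁ p) pl | yes refl with inc p l
  ... | true = ≤-refl
  incDist-adj (inj₂ l) (inj₁ p) (inj₁ p′) pl | no _ with inc p′ l
  ... | true  = s≤s z≤n
  ... | false = ≤-refl

  incDist-≤-within : ∀ d u v → T (within d u v) → incDist P u v ≤ d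
  incDist-≤-within zero u v t with eqV⇒≡ t
  ... | refl = subst (_≤ 0) (sym (incDist-self u)) z≤n
  incDist-≤-within (suc d) u v t with to (T-∨ {within d u v}) t
  ... | inj₁ t′ = m≤n⇒m≤1+n (incDist-≤-within d u v t′)
  ... | inj₂ t′ with anyV⁻ (λ w → adj u w ∧ within d w v) t′
  ...   | w , uwv with to (T-∧ {adj u w}) uwv
  ...     | uw , wv = ≤-trans (incDist-adj u w v uw) (s≤s (incDist-≤-within d w v wv))

  search-least : ∀ fuel d {n} u v → d ≤ n → n < d + fuel → T (within n u v) →
    (∀ i → T (within i u v) → n ≤ i) → search fuel d u v ≡ n
  search-least zero d u v d≤n n<d _ _ = ⊥-elim (<-irrefl refl (≤-trans n<d (subst (_≤ _) (sym (+-identityʳ d)) d≤n)))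
  search-least (suc fuel) d {n} u v d≤n n< wn least with within d u v in e
  ... | true  = ≤-antisym d≤n (least d (subst T (sym e) _))
  ... | false = search-least fuel (suc d) u v (≤∧≢⇒< d≤n d≢n) (subst (n <_) (+-suc d fuel) n<) wn least
    where
      d≢n : d ≢ n
      d≢n refl = subst T e wn

  incDist≤3 : ∀ u v → incDist P u v ≤ 3
  incDist≤3 (inj₁ p) (inj₁ p′) with does (p ≟ p′)
  ... | true  = z≤n
  ... | false = s≤s (s≤s z≤n)
  incDist≤3 (inj₂ l) (inj₂ l′) with does (l ≟ l′)
  ... | true  = z≤n
  ... | false = s≤s (s≤s z≤n)
  incDist≤3 (inj₁ p) (inj₂ l) with inc p l
  ... | true  = s≤s z≤n
  ... | false = ≤-refl
  incDist≤3 (inj₂ l) (inj₁ p) with inc p l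
  ... | true  = s≤s z≤n
  ... | false = ≤-refl

  dist≡incDist : 1 ≤ q → ∀ u v → dist u v ≡ incDist P u v
  dist≡incDist 1≤q u v =
    search-least (N + N) 0 u v z≤n (≤-trans (s≤s (incDist≤3 u v)) 4≤N+N)
      (within-incDist u v) (λ i → incDist-≤-within i u v)
    where
      2≤N : 2 ≤ N
      2≤N = ≤-trans (+-monoˡ-≤ 1 1≤q) (+-monoˡ-≤ 1 (m≤n+m q (q * q)))
      4≤N+N : 4 ≤ N + N
      4≤N+N = +-mono-≤ 2≤N 2≤N

module Responses {q : ℕ} (P : ProjectivePlane q) where
  open ProjectivePlane P
  open Incidence P using (Inc)

  located-by-own-probe : ∀ {a v} → incDist P (inj₁ a) (inj₁ v) ≡ incDist P (inj₁ a) (inj₁ a) → a ≡ v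
  located-by-own-probe {a} {v} e with a ≟ v | a ≟ a
  ... | yes a≡v | _       = a≡v
  ... | no _    | no a≢a = ⊥-elim (a≢a refl)
  located-by-own-probe {a} {v} () | no _ | yes _

  incident-by-probe : ∀ {a l l₀} → incDist P (inj₁ a) (inj₂ l) ≡ incDist P (inj₁ a) (inj₂ l₀) →
    Inc a l₀ → Inc a l
  incident-by-probe {a} {l} {l₀} e al₀ with inc a l | inc a l₀
  ... | true  | _     = _
  ... | false | false = al₀
  incident-by-probe {a} {l} {l₀} () al₀ | false | true

  -- Distances to points and to lines have different parities.
  point-line-responses-differ : ∀ u x y → incDist P u (inj₁ x) ≢ incDist P u (inj₂ y)
  point-line-responses-differ (inj₁ a) x y e with does (a ≟ x) | inc a y
  point-line-responses-differ (inj₁ a) x y () | true  | true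
  point-line-responses-differ (inj₁ a) x y () | true  | false
  point-line-responses-differ (inj₁ a) x y () | false | true
  point-line-responses-differ (inj₁ a) x y () | false | false
  point-line-responses-differ (inj₂ a) x y e with inc x a | does (a ≟ y)
  point-line-responses-differ (inj₂ a) x y () | true  | true
  point-line-responses-differ (inj₂ a) x y () | true  | false
  point-line-responses-differ (inj₂ a) x y () | false | true
  point-line-responses-differ (inj₂ a) x y () | false | false

-- Ceiling division

ceilDiv-monoˡ-≤ : ∀ n {a b} → a ≤ b → ceilDiv a (suc n) ≤ ceilDiv b (suc n)
ceilDiv-monoˡ-≤ n a≤b = /-monoˡ-≤ (suc n) (+-monoˡ-≤ n a≤b)

ceilDiv-pos : ∀ n {a} → 1 ≤ a → 1 ≤ ceilDiv a (suc n)
ceilDiv-pos n 1≤a = m≥n⇒m/n>0 (+-monoˡ-≤ n 1≤a)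

ceilDiv-∸-< : ∀ n {a} → 1 ≤ a → ceilDiv (a ∸ suc n) (suc n) < ceilDiv a (suc n)
ceilDiv-∸-< n {a} 1≤a with ≤-total (suc n) a
... | inj₁ 1+n≤a = ≤-reflexive (begin
  suc ((a ∸ suc n + n) / suc n)   ≡⟨ cong (λ z → suc (z / suc n)) (sym (+-∸-comm n 1+n≤a)) ⟩
  suc ((a + n ∸ suc n) / suc n)   ≡⟨ sym (m/n≡1+[m∸n]/n (≤-trans 1+n≤a (m≤m+n a n))) ⟩
  (a + n) / suc n                 ∎)
  where open ≡-Reasoning
... | inj₂ a≤1+n rewrite m≤n⇒m∸n≡0 a≤1+n | m<n⇒m/n≡0 {n} {suc n} ≤-refl = ceilDiv-pos n 1≤a

ceilDiv-< : ∀ n {a p} → a ≤ p ∸ suc n → 1 ≤ p → ceilDiv a (suc n) < ceilDiv p (suc n)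
ceilDiv-< n a≤ 1≤p = ≤-<-trans (ceilDiv-monoˡ-≤ n a≤) (ceilDiv-∸-< n 1≤p)

m∸[m+n∸o]≤o∸n : ∀ m n o → m ∸ (m + n ∸ o) ≤ o ∸ n
m∸[m+n∸o]≤o∸n m n o with ≤-total o (m + n)
... | inj₁ o≤m+n = ≤-reflexive (begin
  m ∸ t                ≡⟨ sym ([m+n]∸[m+o]≡n∸o n m t) ⟩
  (n + m) ∸ (n + t)    ≡⟨ cong₂ _∸_ (trans (+-comm n m) (sym (m∸n+n≡m o≤m+n))) (+-comm n t) ⟩
  (t + o) ∸ (t + n)    ≡⟨ [m+n]∸[m+o]≡n∸o t o n ⟩
  o ∸ n                ∎)
  where
    open ≡-Reasoning
    t = m + n ∸ o
... | inj₂ m+n≤o rewrite m≤n⇒m∸n≡0 m+n≤o = subst (_≤ o ∸ n) (m+n∸n≡m m n) (∸-monoˡ-≤ n m+n≤o)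

-- Strategies with a decreasing potential

module PotentialArgument (V : Set) (adj : V → V → Bool) (dist : V → V → ℕ) {k : ℕ}
  (State : Set) (Covers : State → V → Set) (Valid : State → Set) (potential : State → ℕ)
  (probes : State → Vec V k) (update : State → Vec ℕ k → State) (start : State) (R : ℕ)
  where
  open Localization V adj dist

  responses : State → V → Vec ℕ k
  responses S v = Vec.map (λ u → dist u v) (probes S)

  Move : V → V → Set
  Move u v = u ≡ v ⊎ T (adj u v)

  Round : State → V → ℕ → Set
  Round S v bound = Valid S′ × Covers S′ v × potential S′ < bound
    where S′ = update S (responses S v)

  module _
    (start-ok : ∀ v → Round start v R)
    (update-ok : ∀ S u v → Valid S → 1 ≤ potential S → Covers S u → Move u v → Round S v (potential S))
    (located : ∀ S u v → Valid S → potential S ≡ 0 → Covers S u → Covers S v → u ≡ v)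
    where

    stateAfter : List (Vec ℕ k) → State
    stateAfter []            = start
    stateAfter (obs ∷ known) = update (stateAfter known) obs

    strategy : Strategy k
    strategy known = probes (stateAfter known)

    -- the state once the responses of round t are known
    state : (ℕ → V) → ℕ → State
    state w t = stateAfter (history strategy w (suc t))

    NotLocatedBefore : (ℕ → V) → ℕ → Set
    NotLocatedBefore w t = ∀ s → s < t → 1 ≤ potential (state w s)

    Invariant : (ℕ → V) → ℕ → Set
    Invariant w t = Valid (state w t) × Covers (state w t) (w t) × potential (state w t) + t < R

    move-of-walk : ∀ {w} → ValidWalk w → ∀ t → Move (w t) (w (suc t))
    move-of-walk vw t with vw t
    ... | inj₁ e = inj₁ (sym e)
    ... | inj₂ a = inj₂ a

    invariant : ∀ w → ValidWalk w → ∀ t → NotLocatedBefore w t → Invariant w t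
    invariant w vw zero _ with start-ok (w 0)
    ... | valid , covers , bound = valid , covers , subst (_< R) (sym (+-identityʳ _)) bound
    invariant w vw (suc t) before with invariant w vw t (λ s s<t → before s (≤-trans s<t (n≤1+n t)))
    ... | valid , covers , bound
      with update-ok (state w t) (w t) (w (suc t)) valid (before t ≤-refl) covers (move-of-walk vw t)
    ...   | valid′ , covers′ , decrease =
            valid′ , covers′ , subst (_< R) (sym (+-suc _ t)) (≤-trans (s≤s (+-monoˡ-< t decrease)) bound)

    first-located : ∀ w → ValidWalk w → ∀ n t → NotLocatedBefore w t → potential (state w t) ≤ n →
      ∃ λ t′ → NotLocatedBefore w t′ × potential (state w t′) ≡ 0
    first-located w vw n t before bound with potential (state w t) in e
    ... | zero = t , before , e
    first-located w vw zero t before () | suc _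
    first-located w vw (suc n) t before bound | suc p =
      first-located w vw n (suc t) before′ (≤-pred (≤-trans decrease (subst (_≤ suc n) (sym e) bound)))
      where
        before′ : NotLocatedBefore w (suc t)
        before′ s s<1+t with m≤n⇒m<n∨m≡n (≤-pred s<1+t)
        ... | inj₁ s<t  = before s s<t
        ... | inj₂ refl = subst (1 ≤_) (sym e) (s≤s z≤n)
        decrease : potential (state w (suc t)) < potential (state w t)
        decrease with invariant w vw t before
        ... | valid , covers , _ =
          proj₂ (proj₂ (update-ok (state w t) (w t) (w (suc t)) valid (subst (1 ≤_) (sym e) (s≤s z≤n))
                                  covers (move-of-walk vw t)))

    history-prefix : ∀ w w′ t s → s ≤ t →
      history strategy w′ (suc t) ≡ history strategy w (suc t) →
      history strategy w′ (suc s) ≡ history strategy w (suc s)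
    history-prefix w w′ zero    zero z≤n same = same
    history-prefix w w′ (suc t) s    s≤t same with m≤n⇒m<n∨m≡n s≤t
    ... | inj₂ refl = same
    ... | inj₁ s<t  = history-prefix w w′ t s (≤-pred s<t) (∷-injectiveʳ same)

    captures : CapturesWithin strategy R
    captures w vw with first-located w vw _ 0 (λ _ ()) ≤-refl
    ... | t , before , located-at-t with invariant w vw t before
    ...   | valid , covers , bound = t , t<R , captured
      where
        t<R : t < R
        t<R = m+n≤o⇒n≤o (potential (state w t)) (subst (_≤ R) (sym (+-suc _ t)) bound)
        captured : CapturedAt strategy w t
        captured w′ vw′ same = located (state w t) (w′ t) (w t) valid located-at-t covers′ covers
          where
            same-state : ∀ s → s ≤ t → state w′ s ≡ state w s
            same-state s s≤t = cong stateAfter (history-prefix w w′ t s s≤t same)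
            before′ : NotLocatedBefore w′ t
            before′ s s<t = subst (λ S → 1 ≤ potential S) (sym (same-state s (<⇒≤ s<t))) (before s s<t)
            covers′ : Covers (state w t) (w′ t)
            covers′ = subst (λ S → Covers S (w′ t)) (same-state t ≤-refl)
                        (proj₁ (proj₂ (invariant w′ vw′ t before′)))

    capt≤ : CaptLE k R
    capt≤ = strategy , captures

-- The pinned phase

-- The robber is known to be on one of the points h ∷ Pr of the line M.  The
-- points of Pr are probed, together with as many points of L other than
-- x = M ∩ L as there are cops left.  The spare candidate h may be x itself
-- (the improper case).
record Pin (A : Set) : Set where
  constructor pin
  field
    M x L h : A
    Pr      : List A

module PinnedState {q : ℕ} (m′ : ℕ) (Q : ProjectivePlane q) where
  open PlaneFacts Q
  open DecMembership (_≟_ {q * q + q + 1}) using (_∈?_)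

  k : ℕ
  k = q + suc m′

  cover : Pin Elem → Vertex q → Bool
  cover (pin M x L h Pr) (inj₁ p) = ⌊ p ∈? h ∷ Pr ⌋
  cover _                 (inj₂ _) = false

  Z : Pin Elem → List Elem
  Z (pin M x L h Pr) = pointsOnExcept L x

  r : Pin Elem → ℕ
  r (pin M x L h Pr) = k ∸ length Pr

  probes : Pin Elem → List (Vertex q)
  probes b@(pin M x L h Pr) = map inj₁ Pr ++ map inj₁ (take (r b) (Z b))

  -- Every round removes at least m′ + 2 = k − q + 1 probed candidates; from the
  -- improper case the next pinned state has q − 2 of them.
  potential : Pin Elem → ℕ
  potential (pin M x L h Pr) =
    if does (h ≟ x) then suc (ceilDiv (q ∸ 2) (suc (suc m′))) else ceilDiv (length Pr) (suc (suc m′))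

  potential-improper : ∀ {M x L h Pr} → h ≡ x → potential (pin M x L h Pr) ≡ suc (ceilDiv (q ∸ 2) (suc (suc m′)))
  potential-improper {x = x} {h = h} h≡x with h ≟ x
  ... | yes _   = refl
  ... | no h≢x = ⊥-elim (h≢x h≡x)

  potential-proper : ∀ {M x L h Pr} → h ≢ x → potential (pin M x L h Pr) ≡ ceilDiv (length Pr) (suc (suc m′))
  potential-proper {x = x} {h = h} h≢x with h ≟ x
  ... | yes h≡x = ⊥-elim (h≢x h≡x)
  ... | no _    = refl

  record Valid (b : Pin Elem) : Set where
    open Pin b
    field
      x∈M    : Inc x M
      x∈L    : Inc x L
      L≢M    : L ≢ M
      on-M   : All (λ p → Inc p M) (h ∷ Pr)
      unique : Unique (h ∷ Pr)
      1≤|Pr| : 1 ≤ length Pr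
      |Pr|≤q : length Pr ≤ q
      mode   : x ∉ h ∷ Pr ⊎ (h ≡ x × 2 ≤ length Pr)

  length-probes : ∀ b → length (Pin.Pr b) ≤ k → length (probes b) ≤ k
  length-probes b@(pin M x L h Pr) |Pr|≤k = begin
    length (map inj₁ Pr ++ map inj₁ (take (r b) (Z b)))   ≡⟨ length-++ (map inj₁ Pr) ⟩
    length (map inj₁ Pr) + length (map inj₁ (take (r b) (Z b)))
      ≡⟨ cong₂ _+_ (length-map inj₁ Pr) (trans (length-map inj₁ (take (r b) (Z b))) (length-take (r b) (Z b))) ⟩
    length Pr + (r b ⊓ length (Z b))                      ≤⟨ +-monoʳ-≤ (length Pr) (m⊓n≤m (r b) (length (Z b))) ⟩
    length Pr + (k ∸ length Pr)                           ≡⟨ m+[n∸m]≡n |Pr|≤k ⟩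
    k                                                     ∎
    where open ≤-Reasoning

  potential-pos : ∀ b → Valid b → 1 ≤ potential b
  potential-pos (pin M x L h Pr) valid with h ≟ x
  ... | yes _ = s≤s z≤n
  ... | no _  = ceilDiv-pos (suc m′) (Valid.1≤|Pr| valid)

module PinnedStep {q : ℕ} (m′ : ℕ) (2≤q : 2 ≤ q) (Q : ProjectivePlane q) where
  open PlaneFacts Q
  open Responses Q
  open PinnedState m′ Q public
  module Next = PinnedState m′ (dual Q)
  open IncidenceGraph Q using (adj)
  open DecListFacts (_≟_ {q * q + q + 1}) using (_without_; ∈-without⁺; ∈-without⁻; without-unique; length-without)
  open DecMembership (_≟_ {q * q + q + 1}) using (_∈?_)

  Outcome : Set
  Outcome = Vertex q ⊎ Pin Elem

  pinOrLocate : Elem → Elem → Elem → Elem → List Elem → Outcome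
  pinOrLocate l M′ x′ L′ (h′ ∷ p′ ∷ rest) = inj₂ (pin M′ x′ L′ h′ (p′ ∷ rest))
  pinOrLocate l M′ x′ L′ _                = inj₁ (inj₂ l)

  -- After a move to a line the candidates are lines through one point: a pinned
  -- state of the dual plane.
  next : Pin Elem → Vertex q → Outcome
  next b (inj₁ p) = inj₁ (inj₁ p)
  next (pin M x L h Pr) (inj₂ l) with l ≟ M
  ... | yes _ = inj₁ (inj₂ l)
  ... | no _ with meet l M ≟ x
  ...   | yes _ with l ≟ L
  ...     | yes _ = inj₁ (inj₂ l)
  ...     | no _  = pinOrLocate l x M (headOr x Pr) (linesThroughExcept x M without L)
  next (pin M x L h Pr) (inj₂ l) | no _ | no _ with meet l L ∈? take (k ∸ length Pr) (pointsOnExcept L x)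
  ... | yes _ = inj₁ (inj₂ l)
  ... | no _  = pinOrLocate l (meet l M) M x (map (join (meet l M)) (drop (k ∸ length Pr) (pointsOnExcept L x)))

  proper : Elem → Elem → Elem → Maybe (Pin Elem)
  proper M x L with pointsOnExcept M x
  ... | h ∷ Pr = just (pin M x L h Pr)
  ... | []     = nothing

  proper-valid : ∀ {M x L p} → Inc x M → Inc x L → L ≢ M → Inc p M → p ≢ x →
    ∃ λ b → proper M x L ≡ just b × Valid b × T (cover b (inj₁ p)) × potential b ≤ ceilDiv q (suc (suc m′))
  proper-valid {M} {x} {L} {p} x∈M x∈L L≢M p∈M p≢x with pointsOnExcept M x in eq
  ... | [] = ⊥-elim (case-[] (subst (p ∈_) eq (∈-pointsOnExcept⁺ p∈M p≢x)))
    where case-[] : p ∉ [] ; case-[] ()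
  ... | h ∷ Pr = pin M x L h Pr , refl , valid , fromWitness {a? = p ∈? h ∷ Pr} p∈ ,
                   subst (_≤ ceilDiv q (suc (suc m′))) (sym (potential-proper {M} {x} {L} {h} {Pr} h≢x))
                     (ceilDiv-monoˡ-≤ (suc m′) |Pr|≤q)
    where
      on-M×≢x : ∀ {y} → y ∈ h ∷ Pr → Inc y M × y ≢ x
      on-M×≢x m = ∈-pointsOnExcept⁻ (subst (_ ∈_) (sym eq) m)
      h≢x : h ≢ x
      h≢x = proj₂ (on-M×≢x (here refl))
      p∈ : p ∈ h ∷ Pr
      p∈ = subst (p ∈_) eq (∈-pointsOnExcept⁺ p∈M p≢x)
      1+|Pr|≡q : suc (length Pr) ≡ q
      1+|Pr|≡q = trans (cong length (sym eq)) (length-pointsOnExcept x∈M)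
      |Pr|≤q : length Pr ≤ q
      |Pr|≤q = subst (length Pr ≤_) 1+|Pr|≡q (n≤1+n (length Pr))
      valid : Valid (pin M x L h Pr)
      valid = record
        { x∈M = x∈M ; x∈L = x∈L ; L≢M = L≢M
        ; on-M = All.tabulate (λ m → proj₁ (on-M×≢x m))
        ; unique = subst Unique eq pointsOnExcept-unique
        ; 1≤|Pr| = ≤-pred (subst (2 ≤_) (sym 1+|Pr|≡q) 2≤q) ; |Pr|≤q = |Pr|≤q
        ; mode = inj₁ (λ m → proj₂ (on-M×≢x m) refl) }

  improper : Elem → Elem → Elem → Pin Elem
  improper M x L = pin M x L x (pointsOnExcept M x)

  improper-valid : ∀ {M x L p} → Inc x M → Inc x L → L ≢ M → Inc p M →
    Valid (improper M x L) × T (cover (improper M x L) (inj₁ p)) ×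
    potential (improper M x L) ≡ suc (ceilDiv (q ∸ 2) (suc (suc m′)))
  improper-valid {M} {x} {L} {p} x∈M x∈L L≢M p∈M =
    valid , fromWitness {a? = p ∈? x ∷ pointsOnExcept M x} p∈ , potential-improper {M} {x} {L} {x} {pointsOnExcept M x} refl
    where
      valid : Valid (improper M x L)
      valid = record
        { x∈M = x∈M ; x∈L = x∈L ; L≢M = L≢M
        ; on-M = x∈M ∷ All.tabulate (λ m → proj₁ (∈-pointsOnExcept⁻ m))
        ; unique = All.tabulate (λ m x≡y → proj₂ (∈-pointsOnExcept⁻ m) (sym x≡y)) ∷ pointsOnExcept-unique
        ; 1≤|Pr| = subst (1 ≤_) (sym (length-pointsOnExcept x∈M)) (≤-trans (s≤s z≤n) 2≤q)
        ; |Pr|≤q = ≤-reflexive (length-pointsOnExcept x∈M)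
        ; mode = inj₂ (refl , subst (2 ≤_) (sym (length-pointsOnExcept x∈M)) 2≤q) }
      p∈ : p ∈ x ∷ pointsOnExcept M x
      p∈ with p ≟ x
      ... | yes refl = here refl
      ... | no p≢x  = there (∈-pointsOnExcept⁺ p∈M p≢x)

  Reachable : Pin Elem → Vertex q → Set
  Reachable b v = ∃ λ u → T (cover b u) × (u ≡ v ⊎ T (adj u v))

  SameResponses : Pin Elem → Vertex q → Vertex q → Set
  SameResponses b v v₀ = ∀ a → a ∈ probes b → incDist Q a v ≡ incDist Q a v₀

  Progress : Pin Elem → Outcome → Vertex q → Set
  Progress b (inj₁ d)  v = v ≡ d
  Progress b (inj₂ b′) v = T (Next.cover b′ (swap v)) × Next.Valid b′ × Next.potential b′ < potential b

  candidates-progress : ∀ b {l l′ M′ x′ L′} (cs : List Elem) → l ∈ cs → l′ ∈ cs →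
    Inc M′ x′ → Inc L′ x′ → L′ ≢ M′ → All (Inc M′) cs → Unique cs → x′ ∉ cs → pred (length cs) ≤ q →
    ceilDiv (pred (length cs)) (suc (suc m′)) < potential b →
    Progress b (pinOrLocate l M′ x′ L′ cs) (inj₂ l′)
  candidates-progress b (_ ∷ []) l∈ l′∈ _ _ _ _ _ _ _ _ = cong inj₂ (length≤1⇒≡ ≤-refl l′∈ l∈)
  candidates-progress b {l′ = l′} {M′} {x′} {L′} cs@(h′ ∷ p′ ∷ rest) _ l′∈
    x′M′ x′L′ L′≢M′ on-M′ unique-cs x′∉ |Pr′|≤q bound =
    fromWitness {a? = l′ ∈? cs} l′∈ , valid ,
    subst (_< potential b) (sym (Next.potential-proper {M′} {x′} {L′} {h′} {p′ ∷ rest} h′≢x′)) bound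
    where
      h′≢x′ : h′ ≢ x′
      h′≢x′ refl = x′∉ (here refl)
      valid : Next.Valid (pin M′ x′ L′ h′ (p′ ∷ rest))
      valid = record
        { x∈M = x′M′ ; x∈L = x′L′ ; L≢M = L′≢M′ ; on-M = on-M′ ; unique = unique-cs
        ; 1≤|Pr| = s≤s z≤n ; |Pr|≤q = |Pr′|≤q ; mode = inj₁ x′∉ }

  line-is-M : ∀ {M x L h} Pr → Valid (pin M x L h Pr) → ∀ {l′} → (∀ {a} → a ∈ Pr → Inc a l′) →
    (∀ {z} → z ∈ take (k ∸ length Pr) (pointsOnExcept L x) → ¬ Inc z l′) → l′ ≡ M
  line-is-M [] valid = ⊥-elim (n≮0 (Valid.1≤|Pr| valid))
  line-is-M {M} (a₁ ∷ a₂ ∷ _) valid {l′} on-l′ _ with l′ ≟ M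
  ... | yes l′≡M = l′≡M
  ... | no l′≢M with Valid.unique valid | Valid.on-M valid
  ...   | _ ∷ (a₁≢a₂ All.∷ _) ∷ _ | _ ∷ a₁M ∷ a₂M ∷ _ =
          ⊥-elim (a₁≢a₂ (point-unique l′≢M (on-l′ (here refl)) a₁M (on-l′ (there (here refl))) a₂M))
  line-is-M {M} {x} {L} (a₁ ∷ []) valid {l′} on-l′ off-l′ with Valid.mode valid
  ... | inj₂ (_ , s≤s ())
  ... | inj₁ x∉ with l′ ≟ M
  ...   | yes l′≡M = l′≡M
  ...   | no l′≢M = ⊥-elim (a₁-off-l′ l′≢M)
    where
      open Valid valid
      a₁M : Inc a₁ M
      a₁M = All.lookup on-M (there (here refl))
      a₁≢x : a₁ ≢ x
      a₁≢x refl = x∉ (there (here refl))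
      -- with a single probed candidate every point of L other than x is probed
      all-probed : take (k ∸ 1) (pointsOnExcept L x) ≡ pointsOnExcept L x
      all-probed = take-all (k ∸ 1) (pointsOnExcept L x)
        (subst (_≤ k ∸ 1) (sym (length-pointsOnExcept x∈L)) (subst (q ≤_) (sym k∸1≡q+m′) (m≤m+n q m′)))
        where
          k∸1≡q+m′ : k ∸ 1 ≡ q + m′
          k∸1≡q+m′ = cong (_∸ 1) (+-suc q m′)
      a₁-off-l′ : l′ ≢ M → ⊥
      a₁-off-l′ l′≢M with l′ ≟ L
      ... | yes refl = a₁≢x (point-unique L≢M (on-l′ (here refl)) a₁M x∈L x∈M)
      ... | no l′≢L with meet-inc l′≢L | meet l′ L ≟ x
      ...   | z∈l′ , z∈L | yes z≡x =
                l′≢M (line-unique a₁≢x (on-l′ (here refl)) (subst (λ p → Inc p l′) z≡x z∈l′) a₁M x∈M)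
      ...   | z∈l′ , z∈L | no z≢x =
                off-l′ (subst (meet l′ L ∈_) (sym all-probed) (∈-pointsOnExcept⁺ z∈L z≢x)) z∈l′

  module Step {M x L h : Elem} {Pr : List Elem} (valid : Valid (pin M x L h Pr)) where
    open Valid valid

    b : Pin Elem
    b = pin M x L h Pr

    candidate-on-M : ∀ {p} → p ∈ h ∷ Pr → Inc p M
    candidate-on-M = All.lookup on-M

    Z-on-L : ∀ {z} → z ∈ pointsOnExcept L x → Inc z L
    Z-on-L zZ = proj₁ (∈-pointsOnExcept⁻ zZ)

    Z-≢x : ∀ {z} → z ∈ pointsOnExcept L x → z ≢ x
    Z-≢x zZ = proj₂ (∈-pointsOnExcept⁻ zZ)

    Z-off-M : ∀ {z} → z ∈ pointsOnExcept L x → ¬ Inc z M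
    Z-off-M zZ zM = Z-≢x zZ (point-unique L≢M (Z-on-L zZ) zM x∈L x∈M)

    1+m′≤r : suc m′ ≤ r b
    1+m′≤r = subst (_≤ r b) (m+n∸m≡n q (suc m′)) (∸-monoʳ-≤ k |Pr|≤q)

    probed-candidate : headOr x Pr ∈ Pr
    probed-candidate = headOr-∈ x 1≤|Pr|

    reachable-point : ∀ {p} → Reachable b (inj₁ p) → p ∈ h ∷ Pr
    reachable-point (inj₁ _ , c , inj₁ refl) = toWitness c

    reachable-line : ∀ {l} → Reachable b (inj₂ l) → ∃ λ p → p ∈ h ∷ Pr × Inc p l
    reachable-line (inj₁ u , c , inj₂ ul) = u , toWitness c , ul

    module _ {v v₀} (same : SameResponses b v v₀) where
      same-at-Pr : ∀ {a} → a ∈ Pr → incDist Q (inj₁ a) v ≡ incDist Q (inj₁ a) v₀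
      same-at-Pr m = same _ (∈-++⁺ˡ (∈-map⁺ inj₁ m))

      same-at-Z : ∀ {a} → a ∈ take (r b) (Z b) → incDist Q (inj₁ a) v ≡ incDist Q (inj₁ a) v₀
      same-at-Z m = same _ (∈-++⁺ʳ (map inj₁ Pr) (∈-map⁺ inj₁ m))

    point-located : ∀ {p₀ p} → Reachable b (inj₁ p₀) → Reachable b (inj₁ p) →
      SameResponses b (inj₁ p) (inj₁ p₀) → p ≡ p₀
    point-located {p₀} {p} r₀ r same = ≡-by-probes (reachable-point r) (reachable-point r₀)
      where
        ≡-by-probes : p ∈ h ∷ Pr → p₀ ∈ h ∷ Pr → p ≡ p₀
        ≡-by-probes (here p≡h) (here p₀≡h) = trans p≡h (sym p₀≡h)
        ≡-by-probes (here _)   (there m₀)  = sym (located-by-own-probe (same-at-Pr same m₀))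
        ≡-by-probes (there m)  _           = located-by-own-probe (sym (same-at-Pr same m))

    module Lines {l l′} (r₀ : Reachable b (inj₂ l)) (r′ : Reachable b (inj₂ l′))
                 (same : SameResponses b (inj₂ l′) (inj₂ l)) where

      on-l-by-Pr : ∀ {a} → a ∈ Pr → Inc a l → Inc a l′
      on-l-by-Pr m = incident-by-probe (same-at-Pr same m)

      on-l′-by-Pr : ∀ {a} → a ∈ Pr → Inc a l′ → Inc a l
      on-l′-by-Pr m = incident-by-probe (sym (same-at-Pr same m))

      on-l-by-Z : ∀ {a} → a ∈ take (r b) (Z b) → Inc a l → Inc a l′
      on-l-by-Z m = incident-by-probe (same-at-Z same m)

      on-l′-by-Z : ∀ {a} → a ∈ take (r b) (Z b) → Inc a l′ → Inc a l
      on-l′-by-Z m = incident-by-probe (sym (same-at-Z same m))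

      along-M : l ≡ M → l′ ≡ l
      along-M refl = line-is-M Pr valid (λ m → on-l-by-Pr m (candidate-on-M (there m)))
                       (λ m zl′ → Z-off-M (∈-take⇒∈ (r b) (Z b) m) (on-l′-by-Z m zl′))

      module OffM (l≢M : l ≢ M) where
        l′≢M : l′ ≢ M
        l′≢M refl = l≢M (line-is-M Pr valid (λ {a} m → on-l′-by-Pr m (candidate-on-M (there m)))
                      (λ m zl → Z-off-M (∈-take⇒∈ (r b) (Z b) m) (on-l-by-Z m zl)))

        y₀ : Elem
        y₀ = meet l M

        y₀∈l : Inc y₀ l
        y₀∈l = proj₁ (meet-inc l≢M)

        y₀∈M : Inc y₀ M
        y₀∈M = proj₂ (meet-inc l≢M)

        meet-candidate : ∀ {l″} → l″ ≢ M → Reachable b (inj₂ l″) → meet l″ M ∈ h ∷ Pr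
        meet-candidate l″≢M rl″ with reachable-line rl″
        ... | p , m , pl″ = subst (_∈ h ∷ Pr) (point-unique l″≢M pl″ (candidate-on-M m) (proj₁ (meet-inc l″≢M)) (proj₂ (meet-inc l″≢M))) m

        y₀-candidate : y₀ ∈ h ∷ Pr
        y₀-candidate = meet-candidate l≢M r₀

        y₀∈l′ : Inc y₀ l′
        y₀∈l′ with y₀-candidate | meet-candidate l′≢M r′
        ... | there m  | _        = on-l-by-Pr m y₀∈l
        ... | here y₀≡h | here y≡h =
              subst (λ p → Inc p l′) (trans y≡h (sym y₀≡h)) (proj₁ (meet-inc l′≢M))
        ... | here _   | there m  =
              subst (λ p → Inc p l′)
                (point-unique l≢M (on-l′-by-Pr m (proj₁ (meet-inc l′≢M))) (proj₂ (meet-inc l′≢M)) y₀∈l y₀∈M)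
                (proj₁ (meet-inc l′≢M))

        module ThroughX (y₀≡x : y₀ ≡ x) where
          spare-is-x : h ≡ x × 2 ≤ length Pr
          spare-is-x with mode
          ... | inj₁ x∉ = ⊥-elim (x∉ (subst (_∈ h ∷ Pr) y₀≡x y₀-candidate))
          ... | inj₂ h≡x,2≤|Pr| = h≡x,2≤|Pr|

          x∈l : Inc x l
          x∈l = subst (λ p → Inc p l) y₀≡x y₀∈l

          x∈l′ : Inc x l′
          x∈l′ = subst (λ p → Inc p l′) y₀≡x y₀∈l′

          probed-on-L : ∃ λ z → z ∈ take (r b) (Z b)
          probed-on-L = ∃-∈-take (≤-trans (s≤s z≤n) 1+m′≤r)
                          (subst (1 ≤_) (sym (length-pointsOnExcept x∈L)) (≤-trans (s≤s z≤n) 2≤q))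

          z : Elem
          z = proj₁ probed-on-L

          z-probed : z ∈ take (r b) (Z b)
          z-probed = proj₂ probed-on-L

          z∈Z : z ∈ Z b
          z∈Z = ∈-take⇒∈ (r b) (Z b) z-probed

          along-L : l ≡ L → l′ ≡ l
          along-L refl = line-unique (Z-≢x z∈Z) (on-l-by-Z z-probed (Z-on-L z∈Z)) x∈l′ (Z-on-L z∈Z) x∈L

          module OffL (l≢L : l ≢ L) where
            l′≢L : l′ ≢ L
            l′≢L refl = l≢L (line-unique (Z-≢x z∈Z) (on-l′-by-Z z-probed (Z-on-L z∈Z)) x∈l (Z-on-L z∈Z) x∈L)

            o : Elem
            o = headOr x Pr

            o≢x : o ≢ x
            o≢x o≡x with unique
            ... | h∉Pr ∷ _ = All.lookup h∉Pr probed-candidate (trans (proj₁ spare-is-x) (sym o≡x))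

            cs : List Elem
            cs = linesThroughExcept x M without L

            ∈cs : ∀ {l″} → Inc x l″ → l″ ≢ M → l″ ≢ L → l″ ∈ cs
            ∈cs xl″ l″≢M l″≢L = ∈-without⁺ (∈-linesThroughExcept⁺ xl″ l″≢M) l″≢L

            ∈cs⁻ : ∀ {l″} → l″ ∈ cs → Inc x l″ × l″ ≢ M
            ∈cs⁻ m = ∈-linesThroughExcept⁻ (proj₁ (∈-without⁻ m))

            1+|cs|≡q : suc (length cs) ≡ q
            1+|cs|≡q = trans (length-without linesThroughExcept-unique (∈-linesThroughExcept⁺ x∈L L≢M))
                             (length-linesThroughExcept x∈M)

            pred|cs|≡q∸2 : pred (length cs) ≡ q ∸ 2
            pred|cs|≡q∸2 = trans (pred[m∸n]≡m∸[1+n] (length cs) 0) (cong (_∸ 2) 1+|cs|≡q)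

            progress : Progress b (pinOrLocate l x M o cs) (inj₂ l′)
            progress = candidates-progress b cs (∈cs x∈l l≢M l≢L) (∈cs x∈l′ l′≢M l′≢L)
              x∈M (candidate-on-M (there probed-candidate)) o≢x (All.tabulate (λ m → proj₁ (∈cs⁻ m)))
              (without-unique linesThroughExcept-unique) (λ m → proj₂ (∈cs⁻ m) refl)
              (subst (_≤ q) (sym pred|cs|≡q∸2) (m∸n≤m q 2))
              (subst (_ <_) (sym (potential-improper {M} {x} {L} {h} {Pr} (proj₁ spare-is-x)))
                 (s≤s (ceilDiv-monoˡ-≤ (suc m′) (≤-reflexive pred|cs|≡q∸2))))

        module OffX (y₀≢x : y₀ ≢ x) where
          y₀∉L : ¬ Inc y₀ L
          y₀∉L y₀L = y₀≢x (point-unique L≢M y₀L y₀∈M x∈L x∈M)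

          l≢L : l ≢ L
          l≢L refl = y₀∉L y₀∈l

          z₀ : Elem
          z₀ = meet l L

          z₀∈l : Inc z₀ l
          z₀∈l = proj₁ (meet-inc l≢L)

          z₀∈L : Inc z₀ L
          z₀∈L = proj₂ (meet-inc l≢L)

          z₀-probed : z₀ ∈ take (r b) (Z b) → l′ ≡ l
          z₀-probed m = line-unique z₀≢y₀ (on-l-by-Z m z₀∈l) y₀∈l′ z₀∈l y₀∈l
            where
              z₀≢y₀ : z₀ ≢ y₀
              z₀≢y₀ z₀≡y₀ = y₀∉L (subst (λ p → Inc p L) z₀≡y₀ z₀∈L)

          module Unprobed (z₀-unprobed : z₀ ∉ take (r b) (Z b)) where
            y₀≢Z : ∀ {z} → z ∈ Z b → y₀ ≢ z
            y₀≢Z m y₀≡z = y₀∉L (subst (λ p → Inc p L) (sym y₀≡z) (Z-on-L m))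

            cs : List Elem
            cs = map (join y₀) (drop (r b) (Z b))

            ∈cs : ∀ {l″} → Inc y₀ l″ → l″ ≢ M → (∀ {z} → z ∈ take (r b) (Z b) → Inc z l″ → Inc z l) → l″ ∈ cs
            ∈cs {l″} y₀l″ l″≢M probed-on-l = via (∈-take⊎drop (r b) (Z b) z∈Z)
              where
                l″≢L : l″ ≢ L
                l″≢L refl = y₀∉L y₀l″
                z = meet l″ L
                zl″ = proj₁ (meet-inc l″≢L)
                zL = proj₂ (meet-inc l″≢L)
                z≢x : z ≢ x
                z≢x z≡x = l″≢M (line-unique (λ e → y₀≢x (sym e)) (subst (λ p → Inc p l″) z≡x zl″) y₀l″ x∈M y₀∈M)
                z∈Z : z ∈ Z b
                z∈Z = ∈-pointsOnExcept⁺ zL z≢x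
                via : z ∈ take (r b) (Z b) ⊎ z ∈ drop (r b) (Z b) → l″ ∈ cs
                via (inj₁ z-probed) = ⊥-elim (z₀-unprobed (subst (_∈ take (r b) (Z b))
                    (point-unique l≢L (probed-on-l z-probed zl″) zL z₀∈l z₀∈L) z-probed))
                via (inj₂ z-unprobed) = subst (_∈ cs)
                    (sym (line-unique (y₀≢Z z∈Z) y₀l″ zl″ (proj₁ (join-inc (y₀≢Z z∈Z))) (proj₂ (join-inc (y₀≢Z z∈Z)))))
                    (∈-map⁺ (join y₀) z-unprobed)

            through-y₀ : ∀ {l″} → l″ ∈ cs → Inc y₀ l″
            through-y₀ m with ∈-map⁻ (join y₀) m
            ... | z , zd , refl = proj₁ (join-inc (y₀≢Z (∈-drop⇒∈ (r b) (Z b) zd)))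

            M∉cs : M ∉ cs
            M∉cs m with ∈-map⁻ (join y₀) m
            ... | z , zd , M≡join = Z-off-M z∈Z (subst (Inc z) (sym M≡join) (proj₂ (join-inc (y₀≢Z z∈Z))))
              where z∈Z = ∈-drop⇒∈ (r b) (Z b) zd

            join-injective : ∀ {a c} → a ∈ drop (r b) (Z b) → c ∈ drop (r b) (Z b) → join y₀ a ≡ join y₀ c → a ≡ c
            join-injective {a} {c} ad cd ja≡jc =
              point-unique ja≢L (proj₂ ja) (Z-on-L a∈Z) (subst (Inc c) (sym ja≡jc) (proj₂ jc)) (Z-on-L c∈Z)
              where
                a∈Z = ∈-drop⇒∈ (r b) (Z b) ad
                c∈Z = ∈-drop⇒∈ (r b) (Z b) cd
                ja = join-inc (y₀≢Z a∈Z)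
                jc = join-inc (y₀≢Z c∈Z)
                ja≢L : join y₀ a ≢ L
                ja≢L ja≡L = y₀∉L (subst (Inc y₀) ja≡L (proj₁ ja))

            pred|cs|≡ : pred (length cs) ≡ pred (q ∸ r b)
            pred|cs|≡ = cong pred (trans (length-map (join y₀) (drop (r b) (Z b)))
                          (trans (length-drop (r b) (Z b)) (cong (_∸ r b) (length-pointsOnExcept x∈L))))

            bound : ceilDiv (pred (length cs)) (suc (suc m′)) < potential b
            bound = by-mode (h ≟ x)
              where
                new = ceilDiv (pred (length cs)) (suc (suc m′))
                by-mode : Dec (h ≡ x) → new < potential b
                by-mode (yes h≡x) =
                  subst (new <_) (sym (potential-improper {M} {x} {L} {h} {Pr} h≡x))
                    (s≤s (ceilDiv-monoˡ-≤ (suc m′) (subst (_≤ q ∸ 2) (sym (trans pred|cs|≡ (pred[m∸n]≡m∸[1+n] q (r b))))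
                      (∸-monoʳ-≤ q (s≤s (≤-trans (s≤s z≤n) 1+m′≤r))))))
                by-mode (no h≢x) =
                  subst (new <_) (sym (potential-proper {M} {x} {L} {h} {Pr} h≢x))
                    (ceilDiv-< (suc m′) (subst₂ _≤_ (sym pred|cs|≡) (pred[m∸n]≡m∸[1+n] (length Pr) (suc m′))
                      (pred-mono-≤ (m∸[m+n∸o]≤o∸n q (suc m′) (length Pr)))) 1≤|Pr|)

            progress : Progress b (pinOrLocate l y₀ M x cs) (inj₂ l′)
            progress = candidates-progress b cs (∈cs y₀∈l l≢M (λ _ zl → zl)) (∈cs y₀∈l′ l′≢M on-l′-by-Z)
              y₀∈M x∈M (λ x≡y₀ → y₀≢x (sym x≡y₀)) (All.tabulate through-y₀)
              (map-unique (join y₀) join-injective (UniqueP.drop⁺ (r b) pointsOnExcept-unique)) M∉cs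
              (subst (_≤ q) (sym pred|cs|≡) (≤-trans pred[n]≤n (m∸n≤m q (r b)))) bound

  next-progress : ∀ b → Valid b → ∀ v₀ v → Reachable b v₀ → Reachable b v → SameResponses b v v₀ →
    Progress b (next b v₀) v
  next-progress (pin M x L h Pr) valid (inj₁ p₀) (inj₁ p) r₀ r same = cong inj₁ (Step.point-located valid r₀ r same)
  next-progress (pin M x L h Pr) valid (inj₁ p₀) (inj₂ l′) r₀ r same =
    ⊥-elim (point-line-responses-differ (inj₁ (headOr x Pr)) p₀ l′
      (sym (Step.same-at-Pr valid same (Step.probed-candidate valid))))
  next-progress (pin M x L h Pr) valid (inj₂ l) (inj₁ p) r₀ r same =
    ⊥-elim (point-line-responses-differ (inj₁ (headOr x Pr)) p l
      (Step.same-at-Pr valid same (Step.probed-candidate valid)))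
  next-progress (pin M x L h Pr) valid (inj₂ l) (inj₂ l′) r₀ r′ same with l ≟ M
  ... | yes l≡M = cong inj₂ (Step.Lines.along-M valid r₀ r′ same l≡M)
  ... | no l≢M with meet l M ≟ x
  ...   | yes y₀≡x with l ≟ L
  ...     | yes l≡L = cong inj₂ (Step.Lines.OffM.ThroughX.along-L valid r₀ r′ same l≢M y₀≡x l≡L)
  ...     | no l≢L  = Step.Lines.OffM.ThroughX.OffL.progress valid r₀ r′ same l≢M y₀≡x l≢L
  next-progress (pin M x L h Pr) valid (inj₂ l) (inj₂ l′) r₀ r′ same | no l≢M | no y₀≢x
    with meet l L ∈? take (k ∸ length Pr) (pointsOnExcept L x)
  ... | yes z₀-probed   = cong inj₂ (Step.Lines.OffM.OffX.z₀-probed valid r₀ r′ same l≢M y₀≢x z₀-probed)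
  ... | no z₀-unprobed = Step.Lines.OffM.OffX.Unprobed.progress valid r₀ r′ same l≢M y₀≢x z₀-unprobed

-- The strategy

module CopStrategy {q : ℕ} (m′ : ℕ) (2≤q : 2 ≤ q) (P : ProjectivePlane q) where
  open ProjectivePlane P using (inc)
  open PlaneFacts P
  open Responses P
  open IncidenceGraph P using (adj; dist; eqV; anyV)
  open GraphDistance P
  open DecMembership (_≟_ {q * q + q + 1}) using (_∈?_)

  k m : ℕ
  k = q + suc m′
  m = suc m′

  planeOf : Bool → ProjectivePlane q
  planeOf false = P
  planeOf true  = dual P

  -- Pinned states of the dual plane are used with points and lines exchanged.
  orient : Bool → Vertex q → Vertex q
  orient false v = v
  orient true  v = swap v

  orient-involutive : ∀ o v → orient o (orient o v) ≡ v
  orient-involutive false v = refl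
  orient-involutive true  v = swap-involutive v

  incDist-orient : ∀ o a b → incDist P (orient o a) (orient o b) ≡ incDist (planeOf o) a b
  incDist-orient false a b = refl
  incDist-orient true  a b = incDist-swap P a b

  adj-orient : ∀ o a b → adj (orient o a) (orient o b) ≡ IncidenceGraph.adj (planeOf o) a b
  adj-orient false a b = refl
  adj-orient true  a b = adj-swap P a b

  module Pinning (o : Bool) = PinnedStep m′ 2≤q (planeOf o)

  ℓ : Elem
  ℓ = fromℕ< (m≤n+m 1 (q * q + q))

  O : Elem
  O = proj₁ (pointOn ℓ)

  O∈ℓ : Inc O ℓ
  O∈ℓ = proj₂ (pointOn ℓ)

  ℓ-probes : List Elem
  ℓ-probes = pointsOnExcept ℓ O

  U₀ : List Elem
  U₀ = linesThroughExcept O ℓ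

  -- In frame U the robber is on a line of U (lines through O other than ℓ) or on
  -- a point off ℓ of such a line.
  data State : Set where
    start   : State
    frame   : List Elem → State
    pinned  : Bool → Pin Elem → State
    located : Vertex q → State

  frameCover : List Elem → Vertex q → Bool
  frameCover U (inj₁ p) = not (inc p ℓ) ∧ any (inc p) U
  frameCover U (inj₂ l) = ⌊ l ∈? U ⌋

  cover : State → Vertex q → Bool
  cover start        _ = true
  cover (frame U)    v = frameCover U v
  cover (pinned o b) v = Pinning.cover o b (orient o v)
  cover (located u)  v = eqV u v

  frameProbes : List Elem → List (Vertex q)
  frameProbes U = map inj₁ ℓ-probes ++ map inj₂ (take m U)

  probeList : State → List (Vertex q)
  probeList start        = frameProbes U₀
  probeList (frame U)    = frameProbes U
  probeList (pinned o b) = map (orient o) (Pinning.probes o b)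
  probeList (located _)  = []

  probes : State → Vec (Vertex q) k
  probes S = toVec k (inj₁ O) (probeList S)

  frameMax : ℕ
  frameMax = ceilDiv q (suc m)

  -- ⌈(|U| − 1)/m⌉ rounds to shrink U to a single line, then the pinned phase.
  potential : State → ℕ
  potential start        = 0
  potential (frame U)    = frameMax + ceilDiv (length U ∸ 1) m
  potential (pinned o b) = Pinning.potential o b
  potential (located _)  = 0

  record ValidFrame (U : List Elem) : Set where
    field
      through-O : All (λ N → Inc O N × N ≢ ℓ) U
      unique    : Unique U
      2≤|U|     : 2 ≤ length U

  Valid : State → Set
  Valid start        = ⊥
  Valid (frame U)    = ValidFrame U
  Valid (pinned o b) = Pinning.Valid o b
  Valid (located _)  = ⊤

  improperPin : Elem → State
  improperPin N = pinned false (Pinning.improper false N O ℓ)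

  properPin : Bool → Elem → Elem → Elem → Vertex q → State
  properPin o M x L v₀ = maybe (pinned o) (located v₀) (Pinning.proper o M x L)

  -- With a single probed line (m = 1) the responses do not tell O from the other
  -- points of that line.
  pinOn : Vertex q → Elem → State
  pinOn v₀ N with m′ ℕ.≟ 0
  ... | yes _ = improperPin N
  ... | no _  = properPin false N O ℓ v₀

  afterPoint : Vertex q → List Elem → State
  afterPoint v₀ U@(_ ∷ _ ∷ _) = frame U
  afterPoint v₀ (N ∷ [])      = properPin false N O ℓ v₀
  afterPoint v₀ []            = located v₀

  afterLine : Vertex q → List Elem → State
  afterLine v₀ U@(_ ∷ _ ∷ _) = frame U
  afterLine v₀ _             = located v₀

  frameNext : List Elem → Vertex q → State
  frameNext U (inj₁ p) with p ≟ O
  ... | yes _ with m′ ℕ.≟ 0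
  ...   | yes _ = improperPin (headOr ℓ U)
  ...   | no _  = located (inj₁ p)
  frameNext U (inj₁ p) | no _ with inc p ℓ
  ... | true  = located (inj₁ p)
  ... | false with Any.any? (λ N → T? (inc p N)) (take m U)
  ...   | yes through = pinOn (inj₁ p) (proj₁ (find through))
  ...   | no _        = afterPoint (inj₁ p) (drop m U)
  frameNext U (inj₂ l) with l ≟ ℓ
  ... | yes _ = located (inj₂ l)
  ... | no _ with inc O l
  ...   | true with l ∈? take m U
  ...     | yes _ = located (inj₂ l)
  ...     | no _  = afterLine (inj₂ l) (drop m U)
  frameNext U (inj₂ l) | no _ | false = properPin true (meet l ℓ) ℓ O (inj₂ l)

  pinnedNext : Bool → Pin Elem → Vertex q → State
  pinnedNext o b v₀ with Pinning.next o b (orient o v₀)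
  ... | inj₁ d  = located (orient o d)
  ... | inj₂ b′ = pinned (not o) b′

  next : State → Vertex q → State
  next start        = frameNext U₀
  next (frame U)    = frameNext U
  next (pinned o b) = pinnedNext o b
  next (located u)  = λ _ → located u

  module LineProbe = Responses (dual P)

  InFrame : List Elem → Vertex q → Set
  InFrame U (inj₁ p) = ¬ Inc p ℓ → ∃ λ N → N ∈ U × Inc p N
  InFrame U (inj₂ l) = Inc O l → l ≢ ℓ → l ∈ U

  SameFrameResponses : List Elem → Vertex q → Vertex q → Set
  SameFrameResponses U v v₀ = ∀ a → a ∈ frameProbes U → incDist P a v ≡ incDist P a v₀

  FrameProgress : List Elem → State → Vertex q → Set
  FrameProgress U S v = Valid S × T (cover S v) × potential S ≤ frameMax + ceilDiv (length U ∸ 1 ∸ m) m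

  ℓ-probe-other-than : ∀ a → ∃ λ b → b ∈ ℓ-probes × b ≢ a
  ℓ-probe-other-than = DecListFacts.∃-other (_≟_ {q * q + q + 1}) pointsOnExcept-unique
    (subst (2 ≤_) (sym (length-pointsOnExcept O∈ℓ)) 2≤q)

  frameMax≤ : ∀ (U : List Elem) → frameMax ≤ frameMax + ceilDiv (length U ∸ 1 ∸ m) m
  frameMax≤ U = m≤m+n frameMax (ceilDiv (length U ∸ 1 ∸ m) m)

  improper≤frameMax : m′ ≡ 0 → suc (ceilDiv (q ∸ 2) (suc m)) ≤ frameMax
  improper≤frameMax m′≡0 =
    subst (λ n → suc (ceilDiv (q ∸ 2) (suc (suc n))) ≤ ceilDiv q (suc (suc n))) (sym m′≡0)
      (ceilDiv-∸-< 1 (≤-trans (s≤s z≤n) 2≤q))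

  located-progress : ∀ U {v d} → v ≡ d → FrameProgress U (located d) v
  located-progress U {v} refl = tt , eqV-refl v , z≤n

  improperPin-progress : ∀ U → ValidFrame U → ∀ {N p} → N ∈ U → m′ ≡ 0 → Inc p N →
    FrameProgress U (improperPin N) (inj₁ p)
  improperPin-progress U W {N} {p} N∈U m′≡0 pN =
    proj₁ facts , proj₁ (proj₂ facts) ,
    subst (_≤ frameMax + ceilDiv (length U ∸ 1 ∸ m) m) (sym (proj₂ (proj₂ facts)))
      (≤-trans (improper≤frameMax m′≡0) (frameMax≤ U))
    where
      O∈N×N≢ℓ : Inc O N × N ≢ ℓ
      O∈N×N≢ℓ = All.lookup (ValidFrame.through-O W) N∈U
      facts = Pinning.improper-valid false {N} {O} {ℓ} {p} (proj₁ O∈N×N≢ℓ) O∈ℓ (λ ℓ≡N → proj₂ O∈N×N≢ℓ (sym ℓ≡N)) pN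

  properPin-progress : ∀ U o {M x L p} v₀ v → orient o v ≡ inj₁ p →
    Incidence.Inc (planeOf o) x M → Incidence.Inc (planeOf o) x L → L ≢ M →
    Incidence.Inc (planeOf o) p M → p ≢ x → FrameProgress U (properPin o M x L v₀) v
  properPin-progress U o {M} {x} {L} v₀ v v↦p xM xL L≢M pM p≢x with Pinning.proper-valid o xM xL L≢M pM p≢x
  ... | b , eq , valid , covers , pot =
    subst (λ pb → FrameProgress U (maybe (pinned o) (located v₀) pb) v) (sym eq)
      (valid , subst (λ w → T (Pinning.cover o b w)) (sym v↦p) covers , ≤-trans pot (frameMax≤ U))

  frame-progress : ∀ U → ValidFrame U → ∀ {U′} → drop m U ≡ U′ → 2 ≤ length U′ → ∀ v →
    T (frameCover U′ v) → FrameProgress U (frame U′) v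
  frame-progress U W {U′} eq 2≤|U′| v covers = valid , covers , ≤-reflexive (cong (λ n → frameMax + ceilDiv n m) |U′|∸1≡)
    where
      open ValidFrame W
      valid : ValidFrame U′
      valid = record
        { through-O = subst (All _) eq (All-drop⁺ m through-O)
        ; unique = subst Unique eq (UniqueP.drop⁺ m unique)
        ; 2≤|U| = 2≤|U′| }
      |U′|∸1≡ : length U′ ∸ 1 ≡ length U ∸ 1 ∸ m
      |U′|∸1≡ = begin
        length U′ ∸ 1        ≡⟨ cong (λ xs → length xs ∸ 1) (sym eq) ⟩
        length (drop m U) ∸ 1 ≡⟨ cong (_∸ 1) (length-drop m U) ⟩
        length U ∸ m ∸ 1     ≡⟨ ∸-+-assoc (length U) m 1 ⟩
        length U ∸ (m + 1)   ≡⟨ cong (length U ∸_) (+-comm m 1) ⟩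
        length U ∸ (1 + m)   ≡⟨ sym (∸-+-assoc (length U) 1 m) ⟩
        length U ∸ 1 ∸ m     ∎
        where open ≡-Reasoning

  afterPoint-progress : ∀ U → ValidFrame U → ∀ v₀ {N p} → N ∈ drop m U → Inc p N → ¬ Inc p ℓ → p ≢ O →
    FrameProgress U (afterPoint v₀ (drop m U)) (inj₁ p)
  afterPoint-progress U W v₀ {N} {p} N∈ pN p∉ℓ p≢O with drop m U in eq
  ... | [] = ⊥-elim (case-[] N∈)
    where case-[] : N ∉ [] ; case-[] ()
  ... | N′ ∷ [] = properPin-progress U false v₀ (inj₁ p) refl O∈N′ O∈ℓ (λ ℓ≡N′ → N′≢ℓ (sym ℓ≡N′))
                    (subst (Inc p) N≡N′ pN) p≢O
    where
      N≡N′ : N ≡ N′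
      N≡N′ = singleton⁻ N∈
      N′∈U : N′ ∈ U
      N′∈U = ∈-drop⇒∈ m U (subst (N′ ∈_) (sym eq) (here refl))
      O∈N′ = proj₁ (All.lookup (ValidFrame.through-O W) N′∈U)
      N′≢ℓ = proj₂ (All.lookup (ValidFrame.through-O W) N′∈U)
  ... | U′@(_ ∷ _ ∷ _) = frame-progress U W eq (s≤s (s≤s z≤n)) (inj₁ p)
                            (from T-∧ (¬T⇒T-not p∉ℓ , any⁺ (inc p) (lose N∈ pN)))

  afterLine-progress : ∀ U → ValidFrame U → ∀ {l l′} → l ∈ drop m U → l′ ∈ drop m U →
    FrameProgress U (afterLine (inj₂ l) (drop m U)) (inj₂ l′)
  afterLine-progress U W {l} {l′} l∈ l′∈ with drop m U in eq
  ... | [] = ⊥-elim (case-[] l∈)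
    where case-[] : l ∉ [] ; case-[] ()
  ... | _ ∷ [] = located-progress U (cong inj₂ (length≤1⇒≡ ≤-refl l′∈ l∈))
  ... | U′@(_ ∷ _ ∷ _) = frame-progress U W eq (s≤s (s≤s z≤n)) (inj₂ l′) (fromWitness {a? = l′ ∈? U′} l′∈)

  head-probed : ∀ {U : List Elem} → 1 ≤ length U → headOr ℓ U ∈ take m U
  head-probed {_ ∷ _} _ = here refl

  module FrameStep {U : List Elem} (W : ValidFrame U) where
    open ValidFrame W

    O∈probed : ∀ {N} → N ∈ take m U → Inc O N
    O∈probed N∈ = proj₁ (All.lookup through-O (∈-take⇒∈ m U N∈))

    head∈ : headOr ℓ U ∈ take m U
    head∈ = head-probed (≤-trans (s≤s z≤n) 2≤|U|)

    pinOn-progress : ∀ v₀ {N p} → N ∈ take m U → Inc p N → (m′ ≢ 0 → p ≢ O) →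
      FrameProgress U (pinOn v₀ N) (inj₁ p)
    pinOn-progress v₀ N∈ pN p≢O with m′ ℕ.≟ 0 | All.lookup through-O (∈-take⇒∈ m U N∈)
    ... | yes m′≡0 | _ = improperPin-progress U W (∈-take⇒∈ m U N∈) m′≡0 pN
    ... | no m′≢0 | O∈N , N≢ℓ =
          properPin-progress U false v₀ (inj₁ _) refl O∈N O∈ℓ (λ ℓ≡N → N≢ℓ (sym ℓ≡N)) pN (p≢O m′≢0)

    module _ {v v₀} (same : SameFrameResponses U v v₀) where
      same-at-ℓ : ∀ {a} → a ∈ ℓ-probes → incDist P (inj₁ a) v ≡ incDist P (inj₁ a) v₀
      same-at-ℓ a∈ = same _ (∈-++⁺ˡ (∈-map⁺ inj₁ a∈))

      same-at-line : ∀ {N} → N ∈ take m U → incDist P (inj₂ N) v ≡ incDist P (inj₂ N) v₀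
      same-at-line N∈ = same _ (∈-++⁺ʳ (map inj₁ ℓ-probes) (∈-map⁺ inj₂ N∈))

    module Points {p p′} (same : SameFrameResponses U (inj₁ p′) (inj₁ p)) where
      on-probed : ∀ {N} → N ∈ take m U → Inc p N → Inc p′ N
      on-probed N∈ = LineProbe.incident-by-probe (same-at-line same N∈)

      on-probed⁻ : ∀ {N} → N ∈ take m U → Inc p′ N → Inc p N
      on-probed⁻ N∈ = LineProbe.incident-by-probe (sym (same-at-line same N∈))

      at-ℓ : Inc p ℓ → p ≢ O → p′ ≡ p
      at-ℓ pℓ p≢O = sym (located-by-own-probe (same-at-ℓ same (∈-pointsOnExcept⁺ pℓ p≢O)))

      O-located : p ≡ O → m′ ≢ 0 → p′ ≡ p
      O-located p≡O m′≢0 with two-in-take m′ unique 2≤|U| m′≢0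
      ... | N₁ , N₂ , N₁∈ , N₂∈ , N₁≢N₂ =
            trans (point-unique N₁≢N₂ (on-probed N₁∈ (p∈ N₁∈)) (on-probed N₂∈ (p∈ N₂∈)) (O∈probed N₁∈) (O∈probed N₂∈))
                  (sym p≡O)
        where
          p∈ : ∀ {N} → N ∈ take m U → Inc p N
          p∈ {N} N∈ = subst (λ w → Inc w N) (sym p≡O) (O∈probed N∈)

      O-on-head : p ≡ O → Inc p′ (headOr ℓ U)
      O-on-head p≡O = on-probed head∈ (subst (λ w → Inc w (headOr ℓ U)) (sym p≡O) (O∈probed head∈))

      ≢O-when-two-probed : p ≢ O → m′ ≢ 0 → p′ ≢ O
      ≢O-when-two-probed p≢O m′≢0 p′≡O with two-in-take m′ unique 2≤|U| m′≢0
      ... | N₁ , N₂ , N₁∈ , N₂∈ , N₁≢N₂ =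
            p≢O (point-unique N₁≢N₂ (on-probed⁻ N₁∈ (p′∈ N₁∈)) (on-probed⁻ N₂∈ (p′∈ N₂∈)) (O∈probed N₁∈) (O∈probed N₂∈))
        where
          p′∈ : ∀ {N} → N ∈ take m U → Inc p′ N
          p′∈ {N} N∈ = subst (λ w → Inc w N) (sym p′≡O) (O∈probed N∈)

      module Unprobed (p∉ℓ : ¬ Inc p ℓ) (p≢O : p ≢ O) (none : ∀ {N} → N ∈ take m U → ¬ Inc p N)
                      (in-frame : InFrame U (inj₁ p′)) where
        p′≢O : p′ ≢ O
        p′≢O p′≡O = none head∈ (on-probed⁻ head∈ (subst (λ w → Inc w (headOr ℓ U)) (sym p′≡O) (O∈probed head∈)))

        p′∉ℓ : ¬ Inc p′ ℓ
        p′∉ℓ p′ℓ = p∉ℓ (subst (λ w → Inc w ℓ)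
                     (located-by-own-probe (sym (same-at-ℓ same (∈-pointsOnExcept⁺ p′ℓ p′≢O)))) p′ℓ)

        N : Elem
        N = proj₁ (in-frame p′∉ℓ)

        p′∈N : Inc p′ N
        p′∈N = proj₂ (proj₂ (in-frame p′∉ℓ))

        N-unprobed : N ∈ drop m U
        N-unprobed = unprobed (∈-take⊎drop m U (proj₁ (proj₂ (in-frame p′∉ℓ))))
          where
            unprobed : N ∈ take m U ⊎ N ∈ drop m U → N ∈ drop m U
            unprobed (inj₁ N-probed) = ⊥-elim (none N-probed (on-probed⁻ N-probed p′∈N))
            unprobed (inj₂ N∈drop)   = N∈drop

        progress : FrameProgress U (afterPoint (inj₁ p) (drop m U)) (inj₁ p′)
        progress = afterPoint-progress U W (inj₁ p) N-unprobed p′∈N p′∉ℓ p′≢O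

    module Lines {l l′} (same : SameFrameResponses U (inj₂ l′) (inj₂ l)) where
      on-ℓ-probe : ∀ {a} → a ∈ ℓ-probes → Inc a l → Inc a l′
      on-ℓ-probe a∈ = incident-by-probe (same-at-ℓ same a∈)

      on-ℓ-probe⁻ : ∀ {a} → a ∈ ℓ-probes → Inc a l′ → Inc a l
      on-ℓ-probe⁻ a∈ = incident-by-probe (sym (same-at-ℓ same a∈))

      along-ℓ : l ≡ ℓ → l′ ≡ l
      along-ℓ l≡ℓ with ℓ-probe-other-than O
      ... | a₁ , a₁∈ , _ with ℓ-probe-other-than a₁
      ...   | a₂ , a₂∈ , a₂≢a₁ =
              line-unique (λ a₁≡a₂ → a₂≢a₁ (sym a₁≡a₂)) (on-ℓ-probe a₁∈ a₁∈l) (on-ℓ-probe a₂∈ a₂∈l) a₁∈l a₂∈l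
        where
          a₁∈l = subst (Inc a₁) (sym l≡ℓ) (proj₁ (∈-pointsOnExcept⁻ a₁∈))
          a₂∈l = subst (Inc a₂) (sym l≡ℓ) (proj₁ (∈-pointsOnExcept⁻ a₂∈))

      probed : l ∈ take m U → l′ ≡ l
      probed l∈ = sym (LineProbe.located-by-own-probe (same-at-line same l∈))

      module ThroughO (l≢ℓ : l ≢ ℓ) (O∈l : Inc O l) (unprobed : l ∉ take m U)
                      (in-frame : InFrame U (inj₂ l)) (in-frame′ : InFrame U (inj₂ l′)) where
        ℓ-probe-off-l : ∀ {a} → a ∈ ℓ-probes → ¬ Inc a l
        ℓ-probe-off-l a∈ al = proj₂ (∈-pointsOnExcept⁻ a∈) (point-unique l≢ℓ al (proj₁ (∈-pointsOnExcept⁻ a∈)) O∈l O∈ℓ)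

        l′≢ℓ : l′ ≢ ℓ
        l′≢ℓ l′≡ℓ with ℓ-probe-other-than O
        ... | a , a∈ , _ = ℓ-probe-off-l a∈ (on-ℓ-probe⁻ a∈ (subst (Inc a) (sym l′≡ℓ) (proj₁ (∈-pointsOnExcept⁻ a∈))))

        O∈l′ : Inc O l′
        O∈l′ = meet-is-O (meet-inc l′≢ℓ) (meet l′ ℓ ≟ O)
          where
            meet-is-O : ∀ {y} → Inc y l′ × Inc y ℓ → Dec (y ≡ O) → Inc O l′
            meet-is-O (y∈l′ , _)   (yes refl) = y∈l′
            meet-is-O (y∈l′ , y∈ℓ) (no y≢O)  = ⊥-elim (ℓ-probe-off-l y∈ (on-ℓ-probe⁻ y∈ y∈l′))
              where y∈ = ∈-pointsOnExcept⁺ y∈ℓ y≢O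

        unprobed′ : l′ ∉ take m U
        unprobed′ l′∈ = unprobed (subst (_∈ take m U) (LineProbe.located-by-own-probe (sym (same-at-line same l′∈))) l′∈)

        in-drop : ∀ {l″} → l″ ∈ U → l″ ∉ take m U → l″ ∈ drop m U
        in-drop l″∈ l″∉ with ∈-take⊎drop m U l″∈
        ... | inj₁ l″-probed = ⊥-elim (l″∉ l″-probed)
        ... | inj₂ l″∈drop   = l″∈drop

        progress : FrameProgress U (afterLine (inj₂ l) (drop m U)) (inj₂ l′)
        progress = afterLine-progress U W (in-drop (in-frame O∈l l≢ℓ) unprobed) (in-drop (in-frame′ O∈l′ l′≢ℓ) unprobed′)

      module OffO (l≢ℓ : l ≢ ℓ) (O∉l : ¬ Inc O l) where
        y₀ : Elem
        y₀ = meet l ℓ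

        y₀∈l : Inc y₀ l
        y₀∈l = proj₁ (meet-inc l≢ℓ)

        y₀∈ℓ : Inc y₀ ℓ
        y₀∈ℓ = proj₂ (meet-inc l≢ℓ)

        y₀≢O : y₀ ≢ O
        y₀≢O y₀≡O = O∉l (subst (λ w → Inc w l) y₀≡O y₀∈l)

        y₀∈l′ : Inc y₀ l′
        y₀∈l′ = on-ℓ-probe (∈-pointsOnExcept⁺ y₀∈ℓ y₀≢O) y₀∈l

        l′≢ℓ : l′ ≢ ℓ
        l′≢ℓ l′≡ℓ with ℓ-probe-other-than y₀
        ... | a , a∈ , a≢y₀ = a≢y₀ (point-unique l≢ℓ (on-ℓ-probe⁻ a∈ (subst (Inc a) (sym l′≡ℓ) aℓ)) aℓ y₀∈l y₀∈ℓ)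
          where aℓ = proj₁ (∈-pointsOnExcept⁻ a∈)

        progress : FrameProgress U (properPin true y₀ ℓ O (inj₂ l)) (inj₂ l′)
        progress = properPin-progress U true (inj₂ l) (inj₂ l′) refl y₀∈ℓ O∈ℓ (λ O≡y₀ → y₀≢O (sym O≡y₀)) y₀∈l′ l′≢ℓ

    progress : ∀ v₀ v → InFrame U v₀ → InFrame U v → SameFrameResponses U v v₀ → FrameProgress U (frameNext U v₀) v
    progress (inj₁ p) (inj₂ l′) _ _ same with ℓ-probe-other-than O
    ... | a , a∈ , _ = ⊥-elim (point-line-responses-differ (inj₁ a) p l′ (sym (same-at-ℓ same a∈)))
    progress (inj₂ l) (inj₁ p′) _ _ same with ℓ-probe-other-than O
    ... | a , a∈ , _ = ⊥-elim (point-line-responses-differ (inj₁ a) p′ l (same-at-ℓ same a∈))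
    progress (inj₁ p) (inj₁ p′) _ in-frame′ same with p ≟ O
    ... | yes p≡O with m′ ℕ.≟ 0
    ...   | yes m′≡0 = improperPin-progress U W (∈-take⇒∈ m U head∈) m′≡0 (Points.O-on-head same p≡O)
    ...   | no m′≢0  = located-progress U (cong inj₁ (Points.O-located same p≡O m′≢0))
    progress (inj₁ p) (inj₁ p′) _ in-frame′ same | no p≢O with inc p ℓ in e
    ... | true  = located-progress U (cong inj₁ (Points.at-ℓ same (subst T (sym e) _) p≢O))
    ... | false with Any.any? (λ N → T? (inc p N)) (take m U)
    ...   | yes through with find through
    ...     | N , N∈ , pN = pinOn-progress (inj₁ p) N∈ (Points.on-probed same N∈ pN)
                              (Points.≢O-when-two-probed same p≢O)
    progress (inj₁ p) (inj₁ p′) _ in-frame′ same | no p≢O | false | no none =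
      Points.Unprobed.progress same (λ pℓ → subst T e pℓ) p≢O (λ N∈ pN → none (lose N∈ pN)) in-frame′
    progress (inj₂ l) (inj₂ l′) in-frame in-frame′ same with l ≟ ℓ
    ... | yes l≡ℓ = located-progress U (cong inj₂ (Lines.along-ℓ same l≡ℓ))
    ... | no l≢ℓ with inc O l in e
    ...   | true with l ∈? take m U
    ...     | yes l-probed = located-progress U (cong inj₂ (Lines.probed same l-probed))
    ...     | no unprobed  = Lines.ThroughO.progress same l≢ℓ (subst T (sym e) _) unprobed (λ _ → in-frame _) in-frame′
    progress (inj₂ l) (inj₂ l′) in-frame in-frame′ same | no l≢ℓ | false =
      Lines.OffO.progress same l≢ℓ (λ O∈l → subst T e O∈l)

  1≤q : 1 ≤ q
  1≤q = ≤-trans (s≤s z≤n) 2≤q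

  Move : Vertex q → Vertex q → Set
  Move u v = u ≡ v ⊎ T (adj u v)

  reach : State → Vertex q → Bool
  reach S v = anyV (λ u → cover S u ∧ (eqV u v ∨ adj u v))

  reach⁺ : ∀ S u v → T (cover S u) → Move u v → T (reach S v)
  reach⁺ S u v covers move =
    anyV⁺ (λ w → cover S w ∧ (eqV w v ∨ adj w v)) u (from T-∧ (covers , from (T-∨ {eqV u v}) (step move)))
    where
      step : Move u v → T (eqV u v) ⊎ T (adj u v)
      step (inj₁ refl) = inj₁ (eqV-refl u)
      step (inj₂ uv)   = inj₂ uv

  reach⁻ : ∀ S v → T (reach S v) → ∃ λ u → T (cover S u) × Move u v
  reach⁻ S v t with anyV⁻ (λ w → cover S w ∧ (eqV w v ∨ adj w v)) t
  ... | u , t′ with to (T-∧ {cover S u}) t′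
  ...   | covers , t″ with to (T-∨ {eqV u v}) t″
  ...     | inj₁ u≡v = u , covers , inj₁ (eqV⇒≡ u≡v)
  ...     | inj₂ uv  = u , covers , inj₂ uv

  responses : State → Vertex q → Vec ℕ k
  responses S v = Vec.map (λ u → dist u v) (probes S)

  consistent : State → Vec ℕ k → Vertex q → Bool
  consistent S obs v = reach S v ∧ ⌊ VecP.≡-dec ℕ._≟_ (responses S v) obs ⌋

  witness? : (f : Vertex q → Bool) → Dec (∃ λ v → T (f v))
  witness? f with any? (λ p → T? (f (inj₁ p))) | any? (λ l → T? (f (inj₂ l)))
  ... | yes (p , t) | _           = yes (inj₁ p , t)
  ... | no _        | yes (l , t) = yes (inj₂ l , t)
  ... | no no-point | no no-line  = no none
    where
      none : ¬ ∃ λ v → T (f v)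
      none (inj₁ p , t) = no-point (p , t)
      none (inj₂ l , t) = no-line (l , t)

  continue : ∀ S {obs} → Dec (∃ λ v → T (consistent S obs v)) → State
  continue S (yes (v₀ , _)) = next S v₀
  continue S (no _)         = S

  update : State → Vec ℕ k → State
  update S obs = continue S (witness? (consistent S obs))

  continue-chooses : ∀ S {obs} (d : Dec (∃ λ v → T (consistent S obs v))) → ∃ (λ v → T (consistent S obs v)) →
    ∃ λ v₀ → continue S d ≡ next S v₀ × T (consistent S obs v₀)
  continue-chooses S (yes (v₀ , t)) _ = v₀ , refl , t
  continue-chooses S (no none)      c = ⊥-elim (none c)

  update-chooses : ∀ S v → T (reach S v) →
    ∃ λ v₀ → update S (responses S v) ≡ next S v₀ × T (reach S v₀) × responses S v₀ ≡ responses S v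
  update-chooses S v rv = v₀ , proj₁ (proj₂ chosen) , proj₁ consistent-v₀ ,
                          toWitness {a? = VecP.≡-dec ℕ._≟_ (responses S v₀) (responses S v)} (proj₂ consistent-v₀)
    where
      v-consistent : T (consistent S (responses S v) v)
      v-consistent = from T-∧ (rv , fromWitness {a? = VecP.≡-dec ℕ._≟_ (responses S v) (responses S v)} refl)
      chosen = continue-chooses S (witness? (consistent S (responses S v))) (v , v-consistent)
      v₀ = proj₁ chosen
      consistent-v₀ = to (T-∧ {reach S v₀}) (proj₂ (proj₂ chosen))

  same-responses : ∀ S v v₀ → length (probeList S) ≤ k → responses S v₀ ≡ responses S v →
    ∀ a → a ∈ probeList S → incDist P a v ≡ incDist P a v₀
  same-responses S v v₀ |probes|≤k eq a a∈ = begin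
    incDist P a v   ≡⟨ sym (dist≡incDist 1≤q a v) ⟩
    dist a v        ≡⟨ toVec-map-≡ (λ u → dist u v) (λ u → dist u v₀) k (inj₁ O) |probes|≤k (sym eq) a∈ ⟩
    dist a v₀       ≡⟨ dist≡incDist 1≤q a v₀ ⟩
    incDist P a v₀  ∎
    where open ≡-Reasoning

  frameProbes-length : ∀ U → length (frameProbes U) ≤ k
  frameProbes-length U = begin
    length (map inj₁ ℓ-probes ++ map inj₂ (take m U))           ≡⟨ length-++ (map inj₁ ℓ-probes) ⟩
    length (map inj₁ ℓ-probes) + length (map inj₂ (take m U))
      ≡⟨ cong₂ _+_ (trans (length-map inj₁ ℓ-probes) (length-pointsOnExcept O∈ℓ))
                   (trans (length-map inj₂ (take m U)) (length-take m U)) ⟩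
    q + (m ⊓ length U)                                           ≤⟨ +-monoʳ-≤ q (m⊓n≤m m (length U)) ⟩
    k                                                            ∎
    where open ≤-Reasoning

  pinnedProbes-length : ∀ o b → Pinning.Valid o b → length (probeList (pinned o b)) ≤ k
  pinnedProbes-length o b valid =
    subst (_≤ k) (sym (length-map (orient o) (Pinning.probes o b)))
      (Pinning.length-probes o b (≤-trans (Pinning.Valid.|Pr|≤q {o} valid) (m≤m+n q m)))

  in-frame : ∀ U → ValidFrame U → ∀ v → T (reach (frame U) v) → InFrame U v
  in-frame U W v t with reach⁻ (frame U) v t
  ... | u , covers , move = covered-move u v covers move
    where
      covered-move : ∀ u v → T (frameCover U u) → Move u v → InFrame U v
      covered-move (inj₂ l) _        covers (inj₁ refl) = λ _ _ → toWitness covers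
      covered-move (inj₂ l) (inj₁ p) covers (inj₂ pl)   = λ _ → l , toWitness covers , pl
      covered-move (inj₁ p) v covers move with to (T-∧ {not (inc p ℓ)}) covers
      ... | p∉ℓ , on-U with find (any⁻ (inc p) U on-U)
      ...   | N , N∈U , pN = from-point v move
        where
          p≢O : p ≢ O
          p≢O p≡O = T-not⇒¬T p∉ℓ (subst (λ w → Inc w ℓ) (sym p≡O) O∈ℓ)
          from-point : ∀ v → Move (inj₁ p) v → InFrame U v
          from-point _        (inj₁ refl) _ = N , N∈U , pN
          from-point (inj₂ l) (inj₂ pl) O∈l _ =
            subst (_∈ U) (sym (line-unique p≢O pl O∈l pN (proj₁ (All.lookup (ValidFrame.through-O W) N∈U)))) N∈U

  in-frame-start : ∀ v → InFrame U₀ v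
  in-frame-start (inj₁ p) p∉ℓ = join O p , ∈-linesThroughExcept⁺ (proj₁ Op) join≢ℓ , proj₂ Op
    where
      O≢p : O ≢ p
      O≢p O≡p = p∉ℓ (subst (λ w → Inc w ℓ) O≡p O∈ℓ)
      Op = join-inc O≢p
      join≢ℓ : join O p ≢ ℓ
      join≢ℓ join≡ℓ = p∉ℓ (subst (Inc p) join≡ℓ (proj₂ Op))
  in-frame-start (inj₂ l) O∈l l≢ℓ = ∈-linesThroughExcept⁺ O∈l l≢ℓ

  U₀-valid : ValidFrame U₀
  U₀-valid = record
    { through-O = All.tabulate ∈-linesThroughExcept⁻
    ; unique = linesThroughExcept-unique
    ; 2≤|U| = subst (2 ≤_) (sym (length-linesThroughExcept O∈ℓ)) 2≤q }

  reachable-pinned : ∀ o b v → T (reach (pinned o b) v) → Pinning.Reachable o b (orient o v)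
  reachable-pinned o b v t with reach⁻ (pinned o b) v t
  ... | u , covers , inj₁ refl = orient o u , covers , inj₁ refl
  ... | u , covers , inj₂ uv   = orient o u , covers , inj₂ (subst T adj≡ uv)
    where
      adj≡ : adj u v ≡ IncidenceGraph.adj (planeOf o) (orient o u) (orient o v)
      adj≡ = trans (sym (cong₂ adj (orient-involutive o u) (orient-involutive o v)))
                   (adj-orient o (orient o u) (orient o v))

  same-pinned : ∀ o b v v₀ → Pinning.Valid o b → responses (pinned o b) v₀ ≡ responses (pinned o b) v →
    Pinning.SameResponses o b (orient o v) (orient o v₀)
  same-pinned o b v v₀ valid eq a a∈ = begin
    incDist (planeOf o) a (orient o v)             ≡⟨ sym (incDist-orient o a (orient o v)) ⟩
    incDist P (orient o a) (orient o (orient o v)) ≡⟨ cong (incDist P (orient o a)) (orient-involutive o v) ⟩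
    incDist P (orient o a) v
      ≡⟨ same-responses (pinned o b) v v₀ (pinnedProbes-length o b valid) eq (orient o a) (∈-map⁺ (orient o) a∈) ⟩
    incDist P (orient o a) v₀                        ≡⟨ cong (incDist P (orient o a)) (sym (orient-involutive o v₀)) ⟩
    incDist P (orient o a) (orient o (orient o v₀)) ≡⟨ incDist-orient o a (orient o v₀) ⟩
    incDist (planeOf o) a (orient o v₀)            ∎
    where open ≡-Reasoning

  -- dual (dual P) is P by η for records.
  flipped-progress : ∀ o b b′ v → Pinning.Progress o b (inj₂ b′) (orient o v) →
    Valid (pinned (not o) b′) × T (cover (pinned (not o) b′) v) × potential (pinned (not o) b′) < Pinning.potential o b
  flipped-progress false b b′ v (covers , valid , lt) = valid , covers , lt
  flipped-progress true  b b′ v (covers , valid , lt) =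
    valid , subst (λ w → T (PinnedState.cover m′ P b′ w)) (swap-involutive v) covers , lt

  pinned-progress : ∀ o b → Pinning.Valid o b → ∀ v₀ v → T (reach (pinned o b) v₀) → T (reach (pinned o b) v) →
    responses (pinned o b) v₀ ≡ responses (pinned o b) v →
    Valid (pinnedNext o b v₀) × T (cover (pinnedNext o b v₀) v) × potential (pinnedNext o b v₀) < Pinning.potential o b
  pinned-progress o b valid v₀ v r₀ r eq
    with Pinning.next o b (orient o v₀)
       | Pinning.next-progress o b valid (orient o v₀) (orient o v)
           (reachable-pinned o b v₀ r₀) (reachable-pinned o b v r) (same-pinned o b v v₀ valid eq)
  ... | inj₁ d  | ov≡d = tt , subst (λ w → T (eqV w v)) (sym (trans (cong (orient o) (sym ov≡d)) (orient-involutive o v))) (eqV-refl v) ,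
                         Pinning.potential-pos o b valid
  ... | inj₂ b′ | progress′ = flipped-progress o b b′ v progress′

  R : ℕ
  R = ceilDiv (q ∸ 1) (k ∸ q) + ceilDiv q (k ∸ q + 1)

  R≡ : R ≡ frameMax + ceilDiv (q ∸ 1) m
  R≡ = begin
    ceilDiv (q ∸ 1) (k ∸ q) + ceilDiv q (k ∸ q + 1)
      ≡⟨ cong₂ _+_ (cong (ceilDiv (q ∸ 1)) k∸q≡m) (cong (ceilDiv q) (trans (cong (_+ 1) k∸q≡m) (+-comm m 1))) ⟩
    ceilDiv (q ∸ 1) m + frameMax  ≡⟨ +-comm (ceilDiv (q ∸ 1) m) frameMax ⟩
    frameMax + ceilDiv (q ∸ 1) m  ∎
    where
      open ≡-Reasoning
      k∸q≡m : k ∸ q ≡ m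
      k∸q≡m = m+n∸m≡n q m

  frame-round : ∀ S U → ValidFrame U → probeList S ≡ frameProbes U → (∀ v₀ → next S v₀ ≡ frameNext U v₀) →
    (∀ w → T (reach S w) → InFrame U w) → ∀ v → T (reach S v) → FrameProgress U (update S (responses S v)) v
  frame-round S U W probes≡ next≡ in-frame′ v rv =
    subst (λ S′ → FrameProgress U S′ v) (sym (trans (proj₁ (proj₂ chosen)) (next≡ v₀)))
      (FrameStep.progress W v₀ v (in-frame′ v₀ (proj₁ (proj₂ (proj₂ chosen)))) (in-frame′ v rv) same)
    where
      chosen = update-chooses S v rv
      v₀ = proj₁ chosen
      same : SameFrameResponses U v v₀
      same a a∈ = same-responses S v v₀ (subst (λ ps → length ps ≤ k) (sym probes≡) (frameProbes-length U))
                    (proj₂ (proj₂ (proj₂ chosen))) a (subst (a ∈_) (sym probes≡) a∈)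

  frame-decrease : ∀ U → ValidFrame U → frameMax + ceilDiv (length U ∸ 1 ∸ m) m < potential (frame U)
  frame-decrease U W = +-monoʳ-< frameMax (ceilDiv-∸-< m′ (∸-monoˡ-≤ 1 (ValidFrame.2≤|U| W)))

  Covers : State → Vertex q → Set
  Covers S v = T (cover S v)

  module Game = PotentialArgument (Vertex q) adj dist State Covers Valid potential probes update start R

  start-ok : ∀ v → Game.Round start v R
  start-ok v = proj₁ progress , proj₁ (proj₂ progress) ,
               subst (potential S′ <_) |U₀|-potential (≤-<-trans (proj₂ (proj₂ progress)) (frame-decrease U₀ U₀-valid))
    where
      S′ : State
      S′ = update start (responses start v)
      progress : FrameProgress U₀ S′ v
      progress = frame-round start U₀ U₀-valid refl (λ _ → refl) (λ w _ → in-frame-start w) v (reach⁺ start v v _ (inj₁ refl))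
      |U₀|-potential : potential (frame U₀) ≡ R
      |U₀|-potential = trans (cong (λ n → frameMax + ceilDiv (n ∸ 1) m) (length-linesThroughExcept O∈ℓ)) (sym R≡)

  update-ok : ∀ S u v → Valid S → 1 ≤ potential S → T (cover S u) → Move u v → Game.Round S v (potential S)
  update-ok start       _ _ () _ _ _
  update-ok (located _) _ _ _ () _ _
  update-ok (frame U) u v W _ covers move =
    proj₁ progress , proj₁ (proj₂ progress) , ≤-<-trans (proj₂ (proj₂ progress)) (frame-decrease U W)
    where
      progress = frame-round (frame U) U W refl (λ _ → refl) (in-frame U W) v (reach⁺ (frame U) u v covers move)
  update-ok (pinned o b) u v valid _ covers move =
    subst (λ S′ → Valid S′ × T (cover S′ v) × potential S′ < Pinning.potential o b) (sym (proj₁ (proj₂ chosen)))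
      (pinned-progress o b valid v₀ v (proj₁ (proj₂ (proj₂ chosen))) rv (proj₂ (proj₂ (proj₂ chosen))))
    where
      rv = reach⁺ (pinned o b) u v covers move
      chosen = update-chooses (pinned o b) v rv
      v₀ = proj₁ chosen

  located-unique : ∀ S u v → Valid S → potential S ≡ 0 → T (cover S u) → T (cover S v) → u ≡ v
  located-unique start      _ _ () _ _ _
  located-unique (located d) u v _ _ cu cv = trans (sym (eqV⇒≡ cu)) (eqV⇒≡ cv)
  located-unique (frame U) u v _ pot≡0 _ _ =
    ⊥-elim (n≮0 (subst (1 ≤_) pot≡0 (≤-trans (ceilDiv-pos (suc m′) 1≤q) (m≤m+n frameMax _))))
  located-unique (pinned o b) u v valid pot≡0 _ _ = ⊥-elim (n≮0 (subst (1 ≤_) pot≡0 (Pinning.potential-pos o b valid)))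

  capt≤R : CaptIncLE P k R
  capt≤R = Game.capt≤ start-ok update-ok located-unique

mainTheorem16 : (q : ℕ) → 2 ≤ q → (P : ProjectivePlane q) →
    (k : ℕ) → q + 1 ≤ k →
    CaptIncLE P k (ceilDiv (q ∸ 1) (k ∸ q) + ceilDiv q (k ∸ q + 1))
mainTheorem16 q 2≤q P k q+1≤k =
  subst (λ k → CaptIncLE P k (ceilDiv (q ∸ 1) (k ∸ q) + ceilDiv q (k ∸ q + 1))) k≡
    (CopStrategy.capt≤R (k ∸ (q + 1)) 2≤q P)
  where
    k≡ : q + suc (k ∸ (q + 1)) ≡ k
    k≡ = trans (sym (+-assoc q 1 (k ∸ (q + 1)))) (m+[n∸m]≡n q+1≤k)
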